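{- Let $N\ge 1$ be an integer. For every integer $n\ge 1$, $$ BC_{N,n}=\Pi(n)\sum_{k=1}^{n}(-D_N)^k\sum_{\substack{i_1,\dots,i_k\ge 1\\ r^{N+i_1}+\cdots+r^{N+i_k}=n+k r^N}}\frac{1}{D_{N+i_1}\cdots D_{N+i_k}}\,. $$
   Context: Let $r$ be a power of a prime, $T$ an indeterminate and $K=\mathbb F_r(T)$. For $i\ge 1$ put $[i]=T^{r^i}-T$ and $D_i=[i][i-1]^r[i-2]^{r^2}\cdots[1]^{r^{i-1}}$, with $D_0=1$. The Carlitz exponential is the formal power series $e_C(x)=\sum_{i=0}^\infty x^{r^i}/D_i\in K[[x]]$. For a non-negative integer $i$ with base-$r$ expansion $i=\sum_{j=0}^m c_j r^j$ ($0\le c_j<r$), the Carlitz factorial is $\Pi(i)=\prod_{j=0}^m D_j^{c_j}$. For $N\ge 1$, the truncated Bernoulli-Carlitz numbers $BC_{N,n}\in K$ are defined by the formal power series identity $$ \frac{x^{r^N}/D_N}{e_C(x)-\sum_{i=0}^{N-1}x^{r^i}/D_i}=\sum_{n=0}^\infty\frac{BC_{N,n}}{\Pi(n)}x^n . $$ -}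

module Defs where

open import Level using (Level; _⊔_) renaming (suc to lsuc)
open import Algebra.Bundles using (CommutativeRing)
open import Data.Nat as ℕ using (ℕ; zero; suc; _^_; _≟_; _≤_)
open import Data.Nat.DivMod using (_/_; _%_)
open import Data.Nat.Primality using (Prime)
open import Data.Fin using (Fin)
open import Data.List using (List; []; _∷_; map; foldr; concatMap; upTo; replicate; _++_; length)
open import Data.Product using (Σ; ∃; _×_; _,_)
open import Data.Bool using (if_then_else_)
open import Relation.Nullary using (¬_)
open import Relation.Nullary.Decidable using (⌊_⌋)
open import Relation.Binary.PropositionalEquality using (_≡_)

record Field (c ℓ : Level) : Set (lsuc (c ⊔ ℓ)) where
  field
    commutativeRing : CommutativeRing c ℓ
  open CommutativeRing commutativeRing public
  field
    0≉1     : ¬ (0# ≈ 1#)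
    inverse : ∀ x → ¬ (x ≈ 0#) → ∃ λ y → (x * y) ≈ 1#

HasCardinality : ∀ {c ℓ} → Field c ℓ → ℕ → Set (c ⊔ ℓ)
HasCardinality F r =
  Σ (Fin r → Carrier) λ e →
    (∀ i j → e i ≈ e j → i ≡ j) × (∀ x → ∃ λ i → e i ≈ x)
  where open Field F

IsPrimePower : ℕ → Set
IsPrimePower r = ∃ λ p → ∃ λ k → Prime p × (1 ≤ k) × (r ≡ p ^ k)

module Carlitz {c ℓ} (F : Field c ℓ) (r : ℕ) where
  open Field F

  -- Polynomials F[T]: coefficient lists, lowest degree first.
  Poly : Set c
  Poly = List Carrier

  coeff : Poly → ℕ → Carrier
  coeff []       _       = 0#
  coeff (a ∷ p)  zero    = a
  coeff (a ∷ p)  (suc n) = coeff p n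

  _≈ₚ_ : Poly → Poly → Set ℓ
  p ≈ₚ q = ∀ n → coeff p n ≈ coeff q n

  0ₚ 1ₚ : Poly
  0ₚ = []
  1ₚ = 1# ∷ []

  _+ₚ_ : Poly → Poly → Poly
  []      +ₚ q       = q
  (a ∷ p) +ₚ []      = a ∷ p
  (a ∷ p) +ₚ (b ∷ q) = (a + b) ∷ (p +ₚ q)

  -ₚ_ : Poly → Poly
  -ₚ p = map -_ p

  _*ₚ_ : Poly → Poly → Poly
  []      *ₚ q = []
  (a ∷ p) *ₚ q = map (a *_) q +ₚ (0# ∷ (p *ₚ q))

  _^ₚ_ : Poly → ℕ → Poly
  p ^ₚ zero  = 1ₚ
  p ^ₚ suc n = p *ₚ (p ^ₚ n)

  T^ : ℕ → Poly
  T^ n = replicate n 0# ++ (1# ∷ [])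

  prodₚ : List Poly → Poly
  prodₚ = foldr _*ₚ_ 1ₚ

  bracket : ℕ → Poly
  bracket i = T^ (r ^ i) +ₚ (-ₚ T^ 1)

  D : ℕ → Poly
  D i = prodₚ (map (λ j → bracket (i ℕ.∸ j) ^ₚ (r ^ j)) (upTo i))

  digit : ℕ → ℕ → ℕ
  digit zero    n = n % suc r' where r' = r ℕ.∸ 1
  digit (suc j) n = digit j (n / suc r') where r' = r ℕ.∸ 1

  -- Carlitz factorial Π(n) = ∏_j D_j^(c_j)  (digits c_j = 0 for j ≥ n)
  CarlitzFact : ℕ → Poly
  CarlitzFact n = prodₚ (map (λ j → D j ^ₚ digit j n) (upTo (suc n)))

  -- K = F(T): fractions num/den, with the usual cross-multiplication
  -- equality.  A fraction is a genuine element of F(T) when Valid.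
  record K : Set c where
    constructor _//_
    field
      num den : Poly
  open K public

  Valid : K → Set ℓ
  Valid x = ¬ (den x ≈ₚ 0ₚ)

  _≈K_ : K → K → Set ℓ
  x ≈K y = (num x *ₚ den y) ≈ₚ (num y *ₚ den x)

  0K 1K : K
  0K = 0ₚ // 1ₚ
  1K = 1ₚ // 1ₚ

  ι : Poly → K
  ι p = p // 1ₚ

  recip : Poly → K
  recip p = 1ₚ // p

  _+K_ : K → K → K
  x +K y = ((num x *ₚ den y) +ₚ (num y *ₚ den x)) // (den x *ₚ den y)

  -K_ : K → K
  -K x = (-ₚ num x) // den x

  _-K_ : K → K → K
  x -K y = x +K (-K y)

  _*K_ : K → K → K
  x *K y = (num x *ₚ num y) // (den x *ₚ den y)

  _^K_ : K → ℕ → K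
  x ^K zero  = 1K
  x ^K suc n = x *K (x ^K n)

  sumK : List K → K
  sumK = foldr _+K_ 0K

  prodK : List K → K
  prodK = foldr _*K_ 1K

  when≡ : ℕ → ℕ → K → K
  when≡ m n x = if ⌊ m ≟ n ⌋ then x else 0K

  Series : Set c
  Series = ℕ → K

  _*S_ : Series → Series → Series
  (f *S g) m = sumK (map (λ j → f j *K g (m ℕ.∸ j)) (upTo (suc m)))

  _-S_ : Series → Series → Series
  (f -S g) m = f m -K g m

  -- coefficient of x^m in e_C(x) = Σ_i x^(r^i)/D_i
  -- (only i ≤ m can have r^i = m, as r ≥ 2)
  eC : Series
  eC m = sumK (map (λ i → when≡ (r ^ i) m (recip (D i))) (upTo (suc m)))

  truncSum : ℕ → Series
  truncSum N m = sumK (map (λ i → when≡ (r ^ i) m (recip (D i))) (upTo N))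

  numerSeries : ℕ → Series
  numerSeries N m = when≡ (r ^ N) m (recip (D N))

  genSeries : (ℕ → K) → Series
  genSeries b n = b n *K recip (CarlitzFact n)

  -- b is the sequence of truncated Bernoulli–Carlitz numbers BC_{N,n}:
  --   (x^(r^N)/D_N) / (e_C(x) - Σ_{i<N} x^(r^i)/D_i) = Σ_n b_n/Π(n) x^n,
  -- i.e. (e_C - trunc) * (Σ b_n/Π(n) x^n) = x^(r^N)/D_N, with all b_n in F(T).
  IsBC : ℕ → (ℕ → K) → Set ℓ
  IsBC N b = (∀ n → Valid (b n)) ×
             (∀ m → ((eC -S truncSum N) *S genSeries b) m ≈K numerSeries N m)

  tuples : ℕ → ℕ → List (List ℕ)
  tuples zero    B = [] ∷ []
  tuples (suc k) B = concatMap (λ i → map (i ∷_) (tuples k B)) (map suc (upTo B))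

  sumℕ : List ℕ → ℕ
  sumℕ = foldr ℕ._+_ 0

  -- Σ_{i_1,…,i_k ≥ 1, r^(N+i_1)+…+r^(N+i_k) = n + k r^N} 1/(D_{N+i_1}⋯D_{N+i_k})
  -- (each such i_j satisfies i_j < r^(N+i_j) ≤ n + k r^N, so the
  --  enumeration bound B = n + k r^N loses no terms)
  innerSum : ℕ → ℕ → ℕ → K
  innerSum N n k =
    sumK (map (λ is → when≡ (sumℕ (map (λ i → r ^ (N ℕ.+ i)) is)) (n ℕ.+ k ℕ.* r ^ N)
                             (prodK (map (λ i → recip (D (N ℕ.+ i))) is)))
              (tuples k (n ℕ.+ k ℕ.* r ^ N)))

  RHS : ℕ → ℕ → K
  RHS N n = ι (CarlitzFact n) *K
            sumK (map (λ k → ((-K ι (D N)) ^K k) *K innerSum N n k)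
                      (map suc (upTo n)))

{-# OPTIONS --safe #-}
-- Put E(x) = e_C(x) - ∑_{i<N} x^(r^i)/D_i = ∑_{t≥0} x^(r^(N+t))/D_(N+t) and g_n = BC_{N,n}/Π(n).
-- Comparing the coefficients of x^(r^N + n) in E(x) · ∑_n g_n x^n = x^(r^N)/D_N gives
--   g_n/D_N + ∑_{t≥1} g_(r^N + n - r^(N+t))/D_(N+t) = [n = 0]/D_N,
-- which determines g_n from the g_m with m < n.  Expanding x^(r^N)/(D_N E(x)) = 1/(1 + u) =
-- ∑_k (-u)^k with u = ∑_{i≥1} D_N/D_(N+i) x^(r^(N+i) - r^N) suggests the candidate
-- c_n = ∑_{k≤n} (-D_N)^k Q(n + k r^N, k), where Q(T, k) is the sum of 1/(D_(N+i_1) ⋯ D_(N+i_k))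
-- over i_1, …, i_k ≥ 1 with r^(N+i_1) + ⋯ + r^(N+i_k) = T.  Splitting off i_1 shows that c
-- satisfies the same recursion, so g = c, and the k = 0 term vanishes for n ≥ 1.
-- F(T) is modelled by fractions over F[T]; as F is finite, its equality is decidable, which makes
-- F[T] an integral domain and cross-multiplication a transitive equality on fractions.

module Submission where

open import Defs
open import Level using (Level; _⊔_)
open import Data.Nat as ℕ using (ℕ; zero; suc; _≤_; _<_; z≤n; s≤s)
open import Data.Product using (Σ; _,_; proj₁; proj₂)
import Data.Nat.Properties as ℕₚ
open import Data.Nat.Induction using (<-rec)
open import Data.Nat.Primality using (prime⇒nonTrivial)
import Data.Fin as Fin
open import Data.Fin using (toℕ)
open import Data.Fin.Properties using (toℕ<n)
open import Data.List using (List; []; _∷_; map; _++_; concatMap; applyUpTo; upTo)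
open import Data.List.Relation.Unary.All using (All; []; _∷_)
import Data.List.Relation.Unary.All.Properties as All
open import Data.Empty using (⊥-elim)
open import Relation.Nullary using (¬_; Dec; yes; no)
open import Relation.Binary.Definitions using (Decidable)
open import Relation.Binary.PropositionalEquality as ≡ using (_≡_; _≢_)
open import Algebra.Bundles using (CommutativeRing)
import Algebra.Properties.Group as GroupProperties
import Algebra.Properties.Ring as RingProperties
import Algebra.Solver.Ring.NaturalCoefficients.Default as Solver
import Relation.Binary.Reasoning.Setoid as SetoidReasoning

n<r^n : ∀ {r} → 2 ≤ r → ∀ n → n < r ℕ.^ n
n<r^n r≥2 zero    = s≤s z≤n
n<r^n r≥2 (suc n) = ℕₚ.<-≤-trans (s≤s (n<r^n r≥2 n)) (ℕₚ.^-monoʳ-< _ r≥2 (ℕₚ.n<1+n n))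

module Polynomials {c ℓ} (F : Field c ℓ) (r : ℕ) where
  open Field F
  open Carlitz F r
  open RingProperties ring using (-0#≈0#)
  open SetoidReasoning setoid
  open Solver commutativeSemiring using (solve; _:=_; _:+_; _:*_)

  -- ≈ₚ wrapped in a record, so that both polynomials can be inferred from a proof
  infix 4 _≃ₚ_
  record _≃ₚ_ (p q : Poly) : Set ℓ where
    constructor coeffwise
    field coeff-≈ : p ≈ₚ q
  open _≃ₚ_ public

  shift : Poly → Poly
  shift p = 0# ∷ p

  infixr 25 _·_
  _·_ : Carrier → Poly → Poly
  a · q = map (a *_) q

  coeff-+ₚ : ∀ p q n → coeff (p +ₚ q) n ≈ coeff p n + coeff q n
  coeff-+ₚ []      q       n       = sym (+-identityˡ _)
  coeff-+ₚ (a ∷ p) []      n       = sym (+-identityʳ _)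
  coeff-+ₚ (a ∷ p) (b ∷ q) zero    = refl
  coeff-+ₚ (a ∷ p) (b ∷ q) (suc n) = coeff-+ₚ p q n

  coeff--ₚ : ∀ p n → coeff (-ₚ p) n ≈ - coeff p n
  coeff--ₚ []      n       = sym -0#≈0#
  coeff--ₚ (a ∷ p) zero    = refl
  coeff--ₚ (a ∷ p) (suc n) = coeff--ₚ p n

  coeff-· : ∀ a q n → coeff (a · q) n ≈ a * coeff q n
  coeff-· a []      n       = sym (zeroʳ a)
  coeff-· a (b ∷ q) zero    = refl
  coeff-· a (b ∷ q) (suc n) = coeff-· a q n

  coeff-shift[] : ∀ n → coeff (shift []) n ≈ 0#
  coeff-shift[] zero    = refl
  coeff-shift[] (suc n) = refl

  ≃ₚ-refl : ∀ {p} → p ≃ₚ p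
  ≃ₚ-refl = coeffwise λ _ → refl

  ≃ₚ-sym : ∀ {p q} → p ≃ₚ q → q ≃ₚ p
  ≃ₚ-sym p≃q = coeffwise λ n → sym (coeff-≈ p≃q n)

  ≃ₚ-trans : ∀ {p q s} → p ≃ₚ q → q ≃ₚ s → p ≃ₚ s
  ≃ₚ-trans p≃q q≃s = coeffwise λ n → trans (coeff-≈ p≃q n) (coeff-≈ q≃s n)

  +ₚ-cong : ∀ {p p′ q q′} → p ≃ₚ p′ → q ≃ₚ q′ → p +ₚ q ≃ₚ p′ +ₚ q′
  +ₚ-cong {p} {p′} {q} {q′} p≃p′ q≃q′ = coeffwise λ n → begin
    coeff (p +ₚ q) n          ≈⟨ coeff-+ₚ p q n ⟩
    coeff p n + coeff q n     ≈⟨ +-cong (coeff-≈ p≃p′ n) (coeff-≈ q≃q′ n) ⟩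
    coeff p′ n + coeff q′ n   ≈⟨ coeff-+ₚ p′ q′ n ⟨
    coeff (p′ +ₚ q′) n        ∎

  +ₚ-assoc : ∀ p q s → (p +ₚ q) +ₚ s ≃ₚ p +ₚ (q +ₚ s)
  +ₚ-assoc p q s = coeffwise λ n → begin
    coeff ((p +ₚ q) +ₚ s) n                ≈⟨ trans (coeff-+ₚ (p +ₚ q) s n) (+-congʳ (coeff-+ₚ p q n)) ⟩
    (coeff p n + coeff q n) + coeff s n    ≈⟨ +-assoc _ _ _ ⟩
    coeff p n + (coeff q n + coeff s n)    ≈⟨ trans (coeff-+ₚ p (q +ₚ s) n) (+-congˡ (coeff-+ₚ q s n)) ⟨
    coeff (p +ₚ (q +ₚ s)) n                ∎

  +ₚ-comm : ∀ p q → p +ₚ q ≃ₚ q +ₚ p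
  +ₚ-comm p q = coeffwise λ n →
    trans (coeff-+ₚ p q n) (trans (+-comm _ _) (sym (coeff-+ₚ q p n)))

  +ₚ-identityˡ : ∀ p → 0ₚ +ₚ p ≃ₚ p
  +ₚ-identityˡ p = ≃ₚ-refl

  +ₚ-identityʳ : ∀ p → p +ₚ 0ₚ ≃ₚ p
  +ₚ-identityʳ p = coeffwise λ n → trans (coeff-+ₚ p [] n) (+-identityʳ _)

  -ₚ-cong : ∀ {p q} → p ≃ₚ q → -ₚ p ≃ₚ -ₚ q
  -ₚ-cong {p} {q} p≃q = coeffwise λ n →
    trans (coeff--ₚ p n) (trans (-‿cong (coeff-≈ p≃q n)) (sym (coeff--ₚ q n)))

  -ₚ-inverseʳ : ∀ p → p +ₚ (-ₚ p) ≃ₚ 0ₚ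
  -ₚ-inverseʳ p = coeffwise λ n →
    trans (coeff-+ₚ p (-ₚ p) n) (trans (+-congˡ (coeff--ₚ p n)) (-‿inverseʳ _))

  -ₚ-inverseˡ : ∀ p → (-ₚ p) +ₚ p ≃ₚ 0ₚ
  -ₚ-inverseˡ p = ≃ₚ-trans (+ₚ-comm (-ₚ p) p) (-ₚ-inverseʳ p)

  shift-cong : ∀ {p q} → p ≃ₚ q → shift p ≃ₚ shift q
  shift-cong p≃q = coeffwise λ { zero → refl ; (suc n) → coeff-≈ p≃q n }

  shift-+ₚ : ∀ p q → shift (p +ₚ q) ≃ₚ shift p +ₚ shift q
  shift-+ₚ p q = coeffwise λ { zero → sym (+-identityˡ 0#) ; (suc n) → refl }

  ·-cong : ∀ {a b p q} → a ≈ b → p ≃ₚ q → a · p ≃ₚ b · q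
  ·-cong {a} {b} {p} {q} a≈b p≃q = coeffwise λ n →
    trans (coeff-· a p n) (trans (*-cong a≈b (coeff-≈ p≃q n)) (sym (coeff-· b q n)))

  ·-distrib-+ₚ : ∀ a p q → a · (p +ₚ q) ≃ₚ a · p +ₚ a · q
  ·-distrib-+ₚ a p q = coeffwise λ n → begin
    coeff (a · (p +ₚ q)) n             ≈⟨ trans (coeff-· a (p +ₚ q) n) (*-congˡ (coeff-+ₚ p q n)) ⟩
    a * (coeff p n + coeff q n)        ≈⟨ distribˡ a _ _ ⟩
    a * coeff p n + a * coeff q n      ≈⟨ trans (coeff-+ₚ (a · p) _ n) (+-cong (coeff-· a p n) (coeff-· a q n)) ⟨
    coeff (a · p +ₚ a · q) n           ∎

  ·-assoc : ∀ a b p → a · b · p ≃ₚ (a * b) · p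
  ·-assoc a b p = coeffwise λ n →
    trans (coeff-· a (b · p) n) (trans (*-congˡ (coeff-· b p n))
      (trans (sym (*-assoc _ _ _)) (sym (coeff-· (a * b) p n))))

  ·-shift : ∀ a p → a · shift p ≃ₚ shift (a · p)
  ·-shift a p = coeffwise λ { zero → zeroʳ a ; (suc n) → refl }

  *ₚ-zeroˡ : ∀ p q → p ≃ₚ 0ₚ → p *ₚ q ≃ₚ 0ₚ
  *ₚ-zeroˡ []      q p≃0 = ≃ₚ-refl
  *ₚ-zeroˡ (a ∷ p) q p≃0 = coeffwise λ n → begin
    coeff (a · q +ₚ shift (p *ₚ q)) n            ≈⟨ coeff-+ₚ (a · q) _ n ⟩
    coeff (a · q) n + coeff (shift (p *ₚ q)) n   ≈⟨ +-cong (coeff-· a q n) (coeff-≈ (shift-cong p*q≃0) n) ⟩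
    a * coeff q n + coeff (shift []) n           ≈⟨ +-cong (*-congʳ (coeff-≈ p≃0 0)) (coeff-shift[] n) ⟩
    0# * coeff q n + 0#                          ≈⟨ trans (+-identityʳ _) (zeroˡ _) ⟩
    0#                                           ∎
    where p*q≃0 = *ₚ-zeroˡ p q (coeffwise λ m → coeff-≈ p≃0 (suc m))

  *ₚ-congˡ : ∀ {p q} s → p ≃ₚ q → p *ₚ s ≃ₚ q *ₚ s
  *ₚ-congˡ {[]}    {[]}    s p≃q = ≃ₚ-refl
  *ₚ-congˡ {[]}    {b ∷ q} s p≃q = ≃ₚ-sym (*ₚ-zeroˡ (b ∷ q) s (≃ₚ-sym p≃q))
  *ₚ-congˡ {a ∷ p} {[]}    s p≃q = *ₚ-zeroˡ (a ∷ p) s p≃q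
  *ₚ-congˡ {a ∷ p} {b ∷ q} s p≃q = +ₚ-cong (·-cong (coeff-≈ p≃q 0) ≃ₚ-refl)
    (shift-cong (*ₚ-congˡ {p} {q} s (coeffwise λ n → coeff-≈ p≃q (suc n))))

  *ₚ-congʳ : ∀ p {q s} → q ≃ₚ s → p *ₚ q ≃ₚ p *ₚ s
  *ₚ-congʳ []      q≃s = ≃ₚ-refl
  *ₚ-congʳ (a ∷ p) q≃s = +ₚ-cong (·-cong refl q≃s) (shift-cong (*ₚ-congʳ p q≃s))

  *ₚ-cong : ∀ {p p′ q q′} → p ≃ₚ p′ → q ≃ₚ q′ → p *ₚ q ≃ₚ p′ *ₚ q′
  *ₚ-cong {p′ = p′} {q} p≃p′ q≃q′ = ≃ₚ-trans (*ₚ-congˡ q p≃p′) (*ₚ-congʳ p′ q≃q′)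

  *ₚ-zeroʳ : ∀ p → p *ₚ 0ₚ ≃ₚ 0ₚ
  *ₚ-zeroʳ []      = ≃ₚ-refl
  *ₚ-zeroʳ (a ∷ p) = ≃ₚ-trans (shift-cong (*ₚ-zeroʳ p)) (coeffwise coeff-shift[])

  *ₚ-identityˡ : ∀ p → 1ₚ *ₚ p ≃ₚ p
  *ₚ-identityˡ p = coeffwise λ n → begin
    coeff (1# · p +ₚ shift []) n          ≈⟨ coeff-+ₚ (1# · p) (shift []) n ⟩
    coeff (1# · p) n + coeff (shift []) n ≈⟨ +-cong (coeff-· 1# p n) (coeff-shift[] n) ⟩
    1# * coeff p n + 0#                   ≈⟨ trans (+-identityʳ _) (*-identityˡ _) ⟩
    coeff p n                             ∎

  *ₚ-∷ʳ : ∀ p b q → p *ₚ (b ∷ q) ≃ₚ b · p +ₚ shift (p *ₚ q)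
  *ₚ-∷ʳ []      b q = ≃ₚ-sym (coeffwise coeff-shift[])
  *ₚ-∷ʳ (a ∷ p) b q = coeffwise λ
    { zero    → +-congʳ (*-comm a b)
    ; (suc n) → begin
        coeff (a · q +ₚ (p *ₚ (b ∷ q))) n
          ≈⟨ trans (coeff-+ₚ (a · q) _ n) (+-cong (coeff-· a q n) (coeff-≈ (*ₚ-∷ʳ p b q) n)) ⟩
        a * coeff q n + coeff (b · p +ₚ shift (p *ₚ q)) n
          ≈⟨ +-congˡ (trans (coeff-+ₚ (b · p) _ n) (+-congʳ (coeff-· b p n))) ⟩
        a * coeff q n + (b * coeff p n + coeff (shift (p *ₚ q)) n)
          ≈⟨ solve 3 (λ x y z → x :+ (y :+ z) := y :+ (x :+ z)) refl _ _ _ ⟩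
        b * coeff p n + (a * coeff q n + coeff (shift (p *ₚ q)) n)
          ≈⟨ +-cong (coeff-· b p n) (trans (coeff-+ₚ (a · q) _ n) (+-congʳ (coeff-· a q n))) ⟨
        coeff (b · p) n + coeff (a · q +ₚ shift (p *ₚ q)) n
          ≈⟨ coeff-+ₚ (b · p) _ n ⟨
        coeff (b · p +ₚ (a · q +ₚ shift (p *ₚ q))) n
          ∎ }

  *ₚ-comm : ∀ p q → p *ₚ q ≃ₚ q *ₚ p
  *ₚ-comm []      q = ≃ₚ-sym (*ₚ-zeroʳ q)
  *ₚ-comm (a ∷ p) q = ≃ₚ-trans (+ₚ-cong ≃ₚ-refl (shift-cong (*ₚ-comm p q))) (≃ₚ-sym (*ₚ-∷ʳ q a p))

  *ₚ-distribʳ : ∀ s p q → (p +ₚ q) *ₚ s ≃ₚ (p *ₚ s) +ₚ (q *ₚ s)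
  *ₚ-distribʳ s []      q       = ≃ₚ-refl
  *ₚ-distribʳ s (a ∷ p) []      = ≃ₚ-sym (+ₚ-identityʳ _)
  *ₚ-distribʳ s (a ∷ p) (b ∷ q) = coeffwise λ n → begin
    coeff ((a + b) · s +ₚ shift ((p +ₚ q) *ₚ s)) n
      ≈⟨ coeff-+ₚ ((a + b) · s) _ n ⟩
    coeff ((a + b) · s) n + coeff (shift ((p +ₚ q) *ₚ s)) n
      ≈⟨ +-cong (coeff-· (a + b) s n)
                (coeff-≈ (≃ₚ-trans (shift-cong (*ₚ-distribʳ s p q)) (shift-+ₚ (p *ₚ s) (q *ₚ s))) n) ⟩
    (a + b) * coeff s n + coeff (shift (p *ₚ s) +ₚ shift (q *ₚ s)) n
      ≈⟨ +-congˡ (coeff-+ₚ (shift (p *ₚ s)) (shift (q *ₚ s)) n) ⟩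
    (a + b) * coeff s n + (coeff (shift (p *ₚ s)) n + coeff (shift (q *ₚ s)) n)
      ≈⟨ solve 5 (λ x y z u v → (x :+ y) :* z :+ (u :+ v) := (x :* z :+ u) :+ (y :* z :+ v)) refl a b _ _ _ ⟩
    (a * coeff s n + coeff (shift (p *ₚ s)) n) + (b * coeff s n + coeff (shift (q *ₚ s)) n)
      ≈⟨ +-cong (trans (coeff-+ₚ (a · s) _ n) (+-congʳ (coeff-· a s n)))
                (trans (coeff-+ₚ (b · s) _ n) (+-congʳ (coeff-· b s n))) ⟨
    coeff ((a ∷ p) *ₚ s) n + coeff ((b ∷ q) *ₚ s) n
      ≈⟨ coeff-+ₚ ((a ∷ p) *ₚ s) _ n ⟨
    coeff (((a ∷ p) *ₚ s) +ₚ ((b ∷ q) *ₚ s)) n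
      ∎

  *ₚ-distribˡ : ∀ s p q → s *ₚ (p +ₚ q) ≃ₚ (s *ₚ p) +ₚ (s *ₚ q)
  *ₚ-distribˡ s p q = ≃ₚ-trans (*ₚ-comm s _)
    (≃ₚ-trans (*ₚ-distribʳ s p q) (+ₚ-cong (*ₚ-comm p s) (*ₚ-comm q s)))

  ·-*ₚ : ∀ a p q → (a · p) *ₚ q ≃ₚ a · (p *ₚ q)
  ·-*ₚ a []      q = ≃ₚ-refl
  ·-*ₚ a (b ∷ p) q = ≃ₚ-trans
    (+ₚ-cong (≃ₚ-sym (·-assoc a b q)) (≃ₚ-trans (shift-cong (·-*ₚ a p q)) (≃ₚ-sym (·-shift a _))))
    (≃ₚ-sym (·-distrib-+ₚ a (b · q) _))

  shift-*ₚ : ∀ p q → shift p *ₚ q ≃ₚ shift (p *ₚ q)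
  shift-*ₚ p q = coeffwise λ n → trans (coeff-+ₚ (0# · q) _ n)
    (trans (+-congʳ (trans (coeff-· 0# q n) (zeroˡ _))) (+-identityˡ _))

  *ₚ-assoc : ∀ p q s → (p *ₚ q) *ₚ s ≃ₚ p *ₚ (q *ₚ s)
  *ₚ-assoc []      q s = ≃ₚ-refl
  *ₚ-assoc (a ∷ p) q s = ≃ₚ-trans (*ₚ-distribʳ s (a · q) (shift (p *ₚ q)))
    (+ₚ-cong (·-*ₚ a q s) (≃ₚ-trans (shift-*ₚ (p *ₚ q) s) (shift-cong (*ₚ-assoc p q s))))

  *ₚ-identityʳ : ∀ p → p *ₚ 1ₚ ≃ₚ p
  *ₚ-identityʳ p = ≃ₚ-trans (*ₚ-comm p 1ₚ) (*ₚ-identityˡ p)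

  Poly-commutativeRing : CommutativeRing c ℓ
  Poly-commutativeRing = record
    { Carrier = Poly ; _≈_ = _≃ₚ_ ; _+_ = _+ₚ_ ; _*_ = _*ₚ_ ; -_ = -ₚ_ ; 0# = 0ₚ ; 1# = 1ₚ
    ; isCommutativeRing = record
      { isRing = record
        { +-isAbelianGroup = record
          { isGroup = record
            { isMonoid = record
              { isSemigroup = record
                { isMagma = record
                  { isEquivalence = record { refl = ≃ₚ-refl ; sym = ≃ₚ-sym ; trans = ≃ₚ-trans }
                  ; ∙-cong = +ₚ-cong }
                ; assoc = +ₚ-assoc }
              ; identity = +ₚ-identityˡ , +ₚ-identityʳ }
            ; inverse = -ₚ-inverseˡ , -ₚ-inverseʳ
            ; ⁻¹-cong = -ₚ-cong }
          ; comm = +ₚ-comm }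
        ; *-cong = *ₚ-cong
        ; *-assoc = *ₚ-assoc
        ; *-identity = *ₚ-identityˡ , *ₚ-identityʳ
        ; distrib = *ₚ-distribˡ , *ₚ-distribʳ }
      ; *-comm = *ₚ-comm } }

module PolynomialDomain {c ℓ} (F : Field c ℓ) (r : ℕ) (_≟_ : Decidable (Field._≈_ F)) where
  open Field F
  open Carlitz F r
  open Polynomials F r
  module P = CommutativeRing Poly-commutativeRing

  *-nonzero : ∀ {a b} → ¬ a ≈ 0# → ¬ b ≈ 0# → ¬ (a * b) ≈ 0#
  *-nonzero {a} {b} a≉0 b≉0 ab≈0 with inverse a a≉0
  ... | a⁻¹ , aa⁻¹≈1 = b≉0 (begin
    b                ≈⟨ trans (sym (*-identityˡ b)) (*-congʳ (sym aa⁻¹≈1)) ⟩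
    (a * a⁻¹) * b    ≈⟨ trans (*-congʳ (*-comm a a⁻¹)) (*-assoc a⁻¹ a b) ⟩
    a⁻¹ * (a * b)    ≈⟨ trans (*-congˡ ab≈0) (zeroʳ a⁻¹) ⟩
    0#               ∎)
    where open SetoidReasoning setoid

  1ₚ-nonzero : ¬ 1ₚ ≈ₚ 0ₚ
  1ₚ-nonzero 1≈0 = 0≉1 (sym (1≈0 0))

  ∷-*ₚ-zero : ∀ {a} p q → a ≈ 0# → (a ∷ p) *ₚ q ≃ₚ shift (p *ₚ q)
  ∷-*ₚ-zero {a} p q a≈0 = ≃ₚ-trans (+ₚ-cong (·-cong {p = q} a≈0 ≃ₚ-refl) (≃ₚ-refl {shift (p *ₚ q)}))
                                   (shift-*ₚ p q)

  *ₚ-∷-zero : ∀ {b} p q → b ≈ 0# → p *ₚ (b ∷ q) ≃ₚ shift (p *ₚ q)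
  *ₚ-∷-zero p q b≈0 = ≃ₚ-trans (*ₚ-comm p _) (≃ₚ-trans (∷-*ₚ-zero q p b≈0) (shift-cong (*ₚ-comm q p)))

  ∷-≉0 : ∀ {a p} → ¬ (a ∷ p) ≈ₚ 0ₚ → a ≈ 0# → ¬ p ≈ₚ 0ₚ
  ∷-≉0 ap≉0 a≈0 p≈0 = ap≉0 λ { zero → a≈0 ; (suc n) → p≈0 n }

  shift-≉0 : ∀ {p} → ¬ p ≈ₚ 0ₚ → ¬ shift p ≈ₚ 0ₚ
  shift-≉0 p≉0 sp≈0 = p≉0 λ n → sp≈0 (suc n)

  ≃ₚ-≉0 : ∀ {p q} → p ≃ₚ q → ¬ p ≈ₚ 0ₚ → ¬ q ≈ₚ 0ₚ
  ≃ₚ-≉0 p≃q p≉0 q≈0 = p≉0 λ n → trans (coeff-≈ p≃q n) (q≈0 n)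

  -- Strip zero constant terms until both constant terms are nonzero.
  ∷-*ₚ-nonzero : ∀ {a} p q → ¬ a ≈ 0# → ¬ q ≈ₚ 0ₚ → ¬ ((a ∷ p) *ₚ q) ≈ₚ 0ₚ
  ∷-*ₚ-nonzero p []      a≉0 q≉0 = ⊥-elim (q≉0 λ _ → refl)
  ∷-*ₚ-nonzero p (b ∷ q) a≉0 q≉0 with b ≟ 0#
  ... | yes b≈0 = ≃ₚ-≉0 (≃ₚ-sym (*ₚ-∷-zero (_ ∷ p) q b≈0))
                         (shift-≉0 (∷-*ₚ-nonzero p q a≉0 (∷-≉0 q≉0 b≈0)))
  ... | no b≉0  = λ apbq≈0 → *-nonzero a≉0 b≉0 (trans (sym (+-identityʳ _)) (apbq≈0 0))

  *ₚ-nonzero : ∀ p q → ¬ p ≈ₚ 0ₚ → ¬ q ≈ₚ 0ₚ → ¬ (p *ₚ q) ≈ₚ 0ₚ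
  *ₚ-nonzero []      q p≉0 q≉0 = ⊥-elim (p≉0 λ _ → refl)
  *ₚ-nonzero (a ∷ p) q p≉0 q≉0 with a ≟ 0#
  ... | yes a≈0 = ≃ₚ-≉0 (≃ₚ-sym (∷-*ₚ-zero p q a≈0)) (shift-≉0 (*ₚ-nonzero p q (∷-≉0 p≉0 a≈0) q≉0))
  ... | no a≉0  = ∷-*ₚ-nonzero p q a≉0 q≉0

  *ₚ-cancelʳ : ∀ p q d → ¬ d ≈ₚ 0ₚ → p *ₚ d ≃ₚ q *ₚ d → p ≃ₚ q
  *ₚ-cancelʳ p q d d≉0 pd≃qd = x∙y⁻¹≈ε⇒x≈y p q (coeffwise p-q≈0)
    where
    open GroupProperties P.+-group using (x∙y⁻¹≈ε⇒x≈y; x≈y⇒x∙y⁻¹≈ε)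
    open RingProperties P.ring using ([y-z]x≈yx-zx)
    [p-q]d≃0 : (p +ₚ (-ₚ q)) *ₚ d ≃ₚ 0ₚ
    [p-q]d≃0 = ≃ₚ-trans ([y-z]x≈yx-zx d p q) (x≈y⇒x∙y⁻¹≈ε pd≃qd)
    p-q≈0 : (p +ₚ (-ₚ q)) ≈ₚ 0ₚ
    p-q≈0 n with coeff (p +ₚ (-ₚ q)) n ≟ 0#
    ... | yes ≈0 = ≈0
    ... | no ≉0  = ⊥-elim (*ₚ-nonzero (p +ₚ (-ₚ q)) d (λ ≈0 → ≉0 (≈0 n)) d≉0 (coeff-≈ [p-q]d≃0))

module Fractions {c ℓ} (F : Field c ℓ) (r : ℕ) (_≟_ : Decidable (Field._≈_ F)) where
  open Carlitz F r
  open Polynomials F r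
  open PolynomialDomain F r _≟_
  open SetoidReasoning P.setoid
  open Solver P.commutativeSemiring using (solve; _:=_; _:+_; _:*_)
  open RingProperties P.ring using (-‿distribˡ-*)

  -- ≈K wrapped in a record, so that both fractions can be inferred from a proof
  infix 4 _≃K_
  record _≃K_ (x y : K) : Set ℓ where
    constructor cross
    field cross-≃ : num x *ₚ den y ≃ₚ num y *ₚ den x
  open _≃K_ public

  ≃K-refl : ∀ {x} → x ≃K x
  ≃K-refl = cross ≃ₚ-refl

  ≃K-sym : ∀ {x y} → x ≃K y → y ≃K x
  ≃K-sym (cross xy) = cross (≃ₚ-sym xy)

  ≃K-trans : ∀ {x y z} → Valid y → x ≃K y → y ≃K z → x ≃K z
  ≃K-trans {a // d} {b // e} {c // f} e≉0 (cross ae≃bd) (cross bf≃ce) =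
    cross (*ₚ-cancelʳ (a *ₚ f) (c *ₚ d) e e≉0 (begin
      (a *ₚ f) *ₚ e   ≈⟨ solve 3 (λ a f e → (a :* f) :* e := (a :* e) :* f) ≃ₚ-refl a f e ⟩
      (a *ₚ e) *ₚ f   ≈⟨ *ₚ-congˡ f ae≃bd ⟩
      (b *ₚ d) *ₚ f   ≈⟨ solve 3 (λ b d f → (b :* d) :* f := (b :* f) :* d) ≃ₚ-refl b d f ⟩
      (b *ₚ f) *ₚ d   ≈⟨ *ₚ-congˡ d bf≃ce ⟩
      (c *ₚ e) *ₚ d   ≈⟨ solve 3 (λ c e d → (c :* e) :* d := (c :* d) :* e) ≃ₚ-refl c e d ⟩
      (c *ₚ d) *ₚ e   ∎))

  +K-cong : ∀ {x x′ y y′} → x ≃K x′ → y ≃K y′ → x +K y ≃K x′ +K y′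
  +K-cong {a // d} {a′ // d′} {b // e} {b′ // e′} (cross ad′≃a′d) (cross be′≃b′e) = cross (begin
    ((a *ₚ e) +ₚ (b *ₚ d)) *ₚ (d′ *ₚ e′)
      ≈⟨ solve 6 (λ a b d e d′ e′ → (a :* e :+ b :* d) :* (d′ :* e′)
                                    := (a :* d′) :* (e :* e′) :+ (b :* e′) :* (d :* d′))
               ≃ₚ-refl a b d e d′ e′ ⟩
    ((a *ₚ d′) *ₚ (e *ₚ e′)) +ₚ ((b *ₚ e′) *ₚ (d *ₚ d′))
      ≈⟨ +ₚ-cong (*ₚ-congˡ (e *ₚ e′) ad′≃a′d) (*ₚ-congˡ (d *ₚ d′) be′≃b′e) ⟩
    ((a′ *ₚ d) *ₚ (e *ₚ e′)) +ₚ ((b′ *ₚ e) *ₚ (d *ₚ d′))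
      ≈⟨ solve 6 (λ a′ b′ d e d′ e′ → (a′ :* d) :* (e :* e′) :+ (b′ :* e) :* (d :* d′)
                                      := (a′ :* e′ :+ b′ :* d′) :* (d :* e))
               ≃ₚ-refl a′ b′ d e d′ e′ ⟩
    ((a′ *ₚ e′) +ₚ (b′ *ₚ d′)) *ₚ (d *ₚ e)
      ∎)

  *K-cong : ∀ {x x′ y y′} → x ≃K x′ → y ≃K y′ → x *K y ≃K x′ *K y′
  *K-cong {a // d} {a′ // d′} {b // e} {b′ // e′} (cross ad′≃a′d) (cross be′≃b′e) = cross (begin
    (a *ₚ b) *ₚ (d′ *ₚ e′)   ≈⟨ solve 4 (λ a b d′ e′ → (a :* b) :* (d′ :* e′) := (a :* d′) :* (b :* e′))
                                      ≃ₚ-refl a b d′ e′ ⟩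
    (a *ₚ d′) *ₚ (b *ₚ e′)   ≈⟨ *ₚ-cong ad′≃a′d be′≃b′e ⟩
    (a′ *ₚ d) *ₚ (b′ *ₚ e)   ≈⟨ solve 4 (λ a′ b′ d e → (a′ :* d) :* (b′ :* e) := (a′ :* b′) :* (d :* e))
                                      ≃ₚ-refl a′ b′ d e ⟩
    (a′ *ₚ b′) *ₚ (d *ₚ e)   ∎)

  -K-cong : ∀ {x y} → x ≃K y → -K x ≃K -K y
  -K-cong {a // d} {b // e} (cross ae≃bd) = cross (begin
    (-ₚ a) *ₚ e      ≈⟨ -‿distribˡ-* a e ⟨
    -ₚ (a *ₚ e)      ≈⟨ -ₚ-cong ae≃bd ⟩
    -ₚ (b *ₚ d)      ≈⟨ -‿distribˡ-* b d ⟩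
    (-ₚ b) *ₚ d      ∎)

  +K-assoc : ∀ x y z → (x +K y) +K z ≃K x +K (y +K z)
  +K-assoc (a // d) (b // e) (c // f) = cross (solve 6 (λ a b c d e f →
    ((a :* e :+ b :* d) :* f :+ c :* (d :* e)) :* (d :* (e :* f)) := (a :* (e :* f) :+ (b :* f :+ c :* e) :* d) :* ((d :* e) :* f))
    ≃ₚ-refl a b c d e f)

  +K-comm : ∀ x y → x +K y ≃K y +K x
  +K-comm (a // d) (b // e) = cross (solve 4 (λ a b d e →
    (a :* e :+ b :* d) :* (e :* d) := (b :* d :+ a :* e) :* (d :* e)) ≃ₚ-refl a b d e)

  +K-identityˡ : ∀ x → 0K +K x ≃K x
  +K-identityˡ (a // d) = cross (solve 3 (λ a d u → (a :* u) :* d := a :* (u :* d)) ≃ₚ-refl a d 1ₚ)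

  +K-identityʳ : ∀ x → x +K 0K ≃K x
  +K-identityʳ (a // d) = cross (≃ₚ-trans (*ₚ-congˡ d (+ₚ-identityʳ (a *ₚ 1ₚ)))
    (solve 3 (λ a d u → (a :* u) :* d := a :* (d :* u)) ≃ₚ-refl a d 1ₚ))

  -K-inverseʳ : ∀ x → x +K (-K x) ≃K 0K
  -K-inverseʳ (a // d) = cross (begin
    ((a *ₚ d) +ₚ ((-ₚ a) *ₚ d)) *ₚ 1ₚ   ≈⟨ *ₚ-identityʳ _ ⟩
    (a *ₚ d) +ₚ ((-ₚ a) *ₚ d)           ≈⟨ +ₚ-cong (≃ₚ-refl {a *ₚ d}) (-‿distribˡ-* a d) ⟨
    (a *ₚ d) +ₚ (-ₚ (a *ₚ d))           ≈⟨ -ₚ-inverseʳ (a *ₚ d) ⟩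
    0ₚ                                  ∎)

  *K-assoc : ∀ x y z → (x *K y) *K z ≃K x *K (y *K z)
  *K-assoc (a // d) (b // e) (c // f) = cross (solve 6 (λ a b c d e f →
    ((a :* b) :* c) :* (d :* (e :* f)) := (a :* (b :* c)) :* ((d :* e) :* f)) ≃ₚ-refl a b c d e f)

  *K-comm : ∀ x y → x *K y ≃K y *K x
  *K-comm (a // d) (b // e) = cross (solve 4 (λ a b d e →
    (a :* b) :* (e :* d) := (b :* a) :* (d :* e)) ≃ₚ-refl a b d e)

  *K-identityˡ : ∀ x → 1K *K x ≃K x
  *K-identityˡ (a // d) = cross (solve 3 (λ a d u → (u :* a) :* d := a :* (u :* d)) ≃ₚ-refl a d 1ₚ)

  *K-identityʳ : ∀ x → x *K 1K ≃K x
  *K-identityʳ (a // d) = cross (solve 3 (λ a d u → (a :* u) :* d := a :* (d :* u)) ≃ₚ-refl a d 1ₚ)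

  -K-inverseˡ : ∀ x → (-K x) +K x ≃K 0K
  -K-inverseˡ (a // d) = cross (≃ₚ-trans (*ₚ-congˡ 1ₚ (+ₚ-comm ((-ₚ a) *ₚ d) (a *ₚ d)))
                                         (cross-≃ (-K-inverseʳ (a // d))))

  *K-distribʳ : ∀ x y z → (y +K z) *K x ≃K (y *K x) +K (z *K x)
  *K-distribʳ (a // d) (b // e) (c // f) = cross (solve 6 (λ a b c d e f →
    ((b :* f :+ c :* e) :* a) :* ((e :* d) :* (f :* d)) := ((b :* a) :* (f :* d) :+ (c :* a) :* (e :* d)) :* ((e :* f) :* d))
    ≃ₚ-refl a b c d e f)

  *K-distribˡ : ∀ x y z → x *K (y +K z) ≃K (x *K y) +K (x *K z)
  *K-distribˡ (a // d) (b // e) (c // f) = cross (solve 6 (λ a b c d e f →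
    (a :* (b :* f :+ c :* e)) :* ((d :* e) :* (d :* f)) := ((a :* b) :* (d :* f) :+ (a :* c) :* (d :* e)) :* (d :* (e :* f)))
    ≃ₚ-refl a b c d e f)

  ι*recip : ∀ p → ι p *K recip p ≃K 1K
  ι*recip p = cross (solve 2 (λ p u → (p :* u) :* u := u :* (u :* p)) ≃ₚ-refl p 1ₚ)

  K⁺ : Set (c ⊔ ℓ)
  K⁺ = Σ K Valid

  infix 4 _≈⁺_
  record _≈⁺_ (x y : K⁺) : Set ℓ where
    constructor lift≃
    field lower≃ : proj₁ x ≃K proj₁ y
  open _≈⁺_ public

  K⁺-commutativeRing : CommutativeRing (c ⊔ ℓ) ℓ
  K⁺-commutativeRing = record
    { Carrier = K⁺
    ; _≈_ = _≈⁺_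
    ; _+_ = λ (x , x≉0) (y , y≉0) → x +K y , *ₚ-nonzero (den x) (den y) x≉0 y≉0
    ; _*_ = λ (x , x≉0) (y , y≉0) → x *K y , *ₚ-nonzero (den x) (den y) x≉0 y≉0
    ; -_ = λ (x , x≉0) → -K x , x≉0
    ; 0# = 0K , 1ₚ-nonzero
    ; 1# = 1K , 1ₚ-nonzero
    ; isCommutativeRing = record
      { isRing = record
        { +-isAbelianGroup = record
          { isGroup = record
            { isMonoid = record
              { isSemigroup = record
                { isMagma = record
                  { isEquivalence = record
                    { refl = lift≃ ≃K-refl
                    ; sym = λ x≈y → lift≃ (≃K-sym (lower≃ x≈y))
                    ; trans = λ {_} {y} x≈y y≈z → lift≃ (≃K-trans (proj₂ y) (lower≃ x≈y) (lower≃ y≈z)) }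
                  ; ∙-cong = λ x≈x′ y≈y′ → lift≃ (+K-cong (lower≃ x≈x′) (lower≃ y≈y′)) }
                ; assoc = λ x y z → lift≃ (+K-assoc (proj₁ x) (proj₁ y) (proj₁ z)) }
              ; identity = (λ x → lift≃ (+K-identityˡ (proj₁ x))) , (λ x → lift≃ (+K-identityʳ (proj₁ x))) }
            ; inverse = (λ x → lift≃ (-K-inverseˡ (proj₁ x))) , (λ x → lift≃ (-K-inverseʳ (proj₁ x)))
            ; ⁻¹-cong = λ x≈y → lift≃ (-K-cong (lower≃ x≈y)) }
          ; comm = λ x y → lift≃ (+K-comm (proj₁ x) (proj₁ y)) }
        ; *-cong = λ x≈x′ y≈y′ → lift≃ (*K-cong (lower≃ x≈x′) (lower≃ y≈y′))
        ; *-assoc = λ x y z → lift≃ (*K-assoc (proj₁ x) (proj₁ y) (proj₁ z))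
        ; *-identity = (λ x → lift≃ (*K-identityˡ (proj₁ x))) , (λ x → lift≃ (*K-identityʳ (proj₁ x)))
        ; distrib = (λ x y z → lift≃ (*K-distribˡ (proj₁ x) (proj₁ y) (proj₁ z)))
                  , (λ x y z → lift≃ (*K-distribʳ (proj₁ x) (proj₁ y) (proj₁ z))) }
      ; *-comm = λ x y → lift≃ (*K-comm (proj₁ x) (proj₁ y)) } }

module FiniteSums {a ℓ} (R : CommutativeRing a ℓ) where
  open CommutativeRing R
  open import Algebra.Properties.Semiring.Sum semiring
    using (sum; sum-cong-≋; sum-replicate-zero; ∑-comm; *-distribˡ-sum; *-distribʳ-sum)
  open SetoidReasoning setoid

  sumL : ∀ {b} {X : Set b} → List X → (X → Carrier) → Carrier
  sumL []       f = 0#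
  sumL (x ∷ xs) f = f x + sumL xs f

  -- ∑ and [_]?_ are opaque, so that their arguments can be recovered by unification
  opaque
    ∑ : ℕ → (ℕ → Carrier) → Carrier
    ∑ n f = sum {n} (λ i → f (toℕ i))

    ∑-suc : ∀ n f → ∑ (suc n) f ≡ f 0 + ∑ n (λ i → f (suc i))
    ∑-suc n f = ≡.refl

    ∑-cong-< : ∀ n {f g} → (∀ i → i < n → f i ≈ g i) → ∑ n f ≈ ∑ n g
    ∑-cong-< n f≈g = sum-cong-≋ (λ i → f≈g (toℕ i) (toℕ<n i))

    ∑-zero : ∀ n {f} → (∀ i → i < n → f i ≈ 0#) → ∑ n f ≈ 0#
    ∑-zero n f≈0 = trans (∑-cong-< n f≈0) (sum-replicate-zero n)

    ∑-*ˡ : ∀ n x f → x * ∑ n f ≈ ∑ n (λ i → x * f i)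
    ∑-*ˡ n x f = *-distribˡ-sum {n} x (λ i → f (toℕ i))

    ∑-*ʳ : ∀ n x f → ∑ n f * x ≈ ∑ n (λ i → f i * x)
    ∑-*ʳ n x f = *-distribʳ-sum {n} x (λ i → f (toℕ i))

    ∑-swap : ∀ m n (f : ℕ → ℕ → Carrier) → ∑ m (λ i → ∑ n (f i)) ≈ ∑ n (λ j → ∑ m (λ i → f i j))
    ∑-swap m n f = ∑-comm {m} {n} (λ i j → f (toℕ i) (toℕ j))

    ∑-split : ∀ m n f → ∑ (m ℕ.+ n) f ≈ ∑ m f + ∑ n (λ i → f (m ℕ.+ i))
    ∑-split zero    n f = sym (+-identityˡ _)
    ∑-split (suc m) n f = trans (+-congˡ (∑-split m n (λ i → f (suc i)))) (sym (+-assoc _ _ _))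

    sumL-applyUpTo : ∀ (g : ℕ → ℕ) n f → sumL (applyUpTo g n) f ≡ ∑ n (λ i → f (g i))
    sumL-applyUpTo g zero    f = ≡.refl
    sumL-applyUpTo g (suc n) f = ≡.cong (f (g 0) +_) (sumL-applyUpTo (λ i → g (suc i)) n f)

  ∑-cong : ∀ n {f g} → (∀ i → f i ≈ g i) → ∑ n f ≈ ∑ n g
  ∑-cong n f≈g = ∑-cong-< n (λ i _ → f≈g i)

  ∑-extend : ∀ {m n} f → m ≤ n → (∀ i → m ≤ i → i < n → f i ≈ 0#) → ∑ m f ≈ ∑ n f
  ∑-extend {m} {n} f m≤n f≈0 = begin
    ∑ m f                                      ≈⟨ +-identityʳ _ ⟨
    ∑ m f + 0#                                 ≈⟨ +-congˡ (∑-zero (n ℕ.∸ m) tail≈0) ⟨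
    ∑ m f + ∑ (n ℕ.∸ m) (λ i → f (m ℕ.+ i))    ≈⟨ ∑-split m (n ℕ.∸ m) f ⟨
    ∑ (m ℕ.+ (n ℕ.∸ m)) f                      ≡⟨ ≡.cong (λ k → ∑ k f) (ℕₚ.m+[n∸m]≡n m≤n) ⟩
    ∑ n f                                      ∎
    where
    tail≈0 : ∀ i → i < n ℕ.∸ m → f (m ℕ.+ i) ≈ 0#
    tail≈0 i i<n∸m = f≈0 (m ℕ.+ i) (ℕₚ.m≤m+n m i)
      (≡.subst (m ℕ.+ i <_) (ℕₚ.m+[n∸m]≡n m≤n) (ℕₚ.+-monoʳ-< m i<n∸m))

  ∑-single : ∀ {n k} f → k < n → (∀ j → j < n → j ≢ k → f j ≈ 0#) → ∑ n f ≈ f k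
  ∑-single {suc n} {zero}  f k<n f≈0 = begin
    ∑ (suc n) f                        ≡⟨ ∑-suc n f ⟩
    f 0 + ∑ n (λ i → f (suc i))        ≈⟨ +-congˡ (∑-zero n λ i i<n → f≈0 (suc i) (s≤s i<n) λ ()) ⟩
    f 0 + 0#                           ≈⟨ +-identityʳ _ ⟩
    f 0                                ∎
  ∑-single {suc n} {suc k} f (s≤s k<n) f≈0 = begin
    ∑ (suc n) f                        ≡⟨ ∑-suc n f ⟩
    f 0 + ∑ n (λ i → f (suc i))        ≈⟨ +-congʳ (f≈0 0 (s≤s z≤n) λ ()) ⟩
    0# + ∑ n (λ i → f (suc i))         ≈⟨ +-identityˡ _ ⟩
    ∑ n (λ i → f (suc i))              ≈⟨ ∑-single (λ i → f (suc i)) k<n f≈0′ ⟩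
    f (suc k)                          ∎
    where
    f≈0′ : ∀ j → j < n → j ≢ k → f (suc j) ≈ 0#
    f≈0′ j j<n j≢k = f≈0 (suc j) (s≤s j<n) (λ sj≡sk → j≢k (ℕₚ.suc-injective sj≡sk))

  infix 10 [_]?_
  opaque
    [_]?_ : ∀ {p} {A : Set p} → Dec A → Carrier → Carrier
    [ yes _ ]? x = x
    [ no _  ]? x = 0#

    [yes]?≡ : ∀ {p} {A : Set p} (a : A) x → [ yes a ]? x ≡ x
    [yes]?≡ a x = ≡.refl

    [no]?≡ : ∀ {p} {A : Set p} (¬a : ¬ A) x → [ no ¬a ]? x ≡ 0#
    [no]?≡ ¬a x = ≡.refl

    []?-yes : ∀ {p} {A : Set p} (d : Dec A) {x} → A → [ d ]? x ≈ x
    []?-yes (yes _) _ = refl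
    []?-yes (no ¬a) a = ⊥-elim (¬a a)

    []?-no : ∀ {p} {A : Set p} (d : Dec A) {x} → ¬ A → [ d ]? x ≈ 0#
    []?-no (yes a) ¬a = ⊥-elim (¬a a)
    []?-no (no _)  _  = refl

    []?-cong : ∀ {p} {A : Set p} (d : Dec A) {x y} → (A → x ≈ y) → [ d ]? x ≈ [ d ]? y
    []?-cong (yes a) x≈y = x≈y a
    []?-cong (no _)  _   = refl

    []?-≈0 : ∀ {p} {A : Set p} (d : Dec A) {x} → (A → x ≈ 0#) → [ d ]? x ≈ 0#
    []?-≈0 (yes a) x≈0 = x≈0 a
    []?-≈0 (no _)  _   = refl

    sumL-[]?-*ˡ : ∀ {p b} {A : Set p} {X : Set b} (d : Dec A) (xs : List X) x f →
                  sumL xs (λ y → [ d ]? (x * f y)) ≈ [ d ]? (x * sumL xs f)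
    sumL-[]?-*ˡ (yes _) xs x f = sym (sumL-*ˡ xs x f)
      where
      sumL-*ˡ : ∀ {b} {X : Set b} (xs : List X) x f → x * sumL xs f ≈ sumL xs (λ y → x * f y)
      sumL-*ˡ []       x f = zeroʳ x
      sumL-*ˡ (y ∷ xs) x f = trans (distribˡ x _ _) (+-congˡ (sumL-*ˡ xs x f))
    sumL-[]?-*ˡ (no _)  xs x f = sumL-zero xs
      where
      sumL-zero : ∀ {b} {X : Set b} (xs : List X) → sumL xs (λ _ → 0#) ≈ 0#
      sumL-zero []       = refl
      sumL-zero (x ∷ xs) = trans (+-identityˡ _) (sumL-zero xs)

  [+≟]?-* : ∀ a s n x y → [ a ℕ.+ s ℕ.≟ n ]? (x * y) ≈ [ a ℕ.≤? n ]? (x * [ s ℕ.≟ n ℕ.∸ a ]? y)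
  [+≟]?-* a s n x y with a ℕ.≤? n | s ℕ.≟ n ℕ.∸ a
  ... | yes a≤n | yes s≡n∸a = begin
    [ a ℕ.+ s ℕ.≟ n ]? (x * y)          ≈⟨ []?-yes (a ℕ.+ s ℕ.≟ n)
                                             (≡.trans (≡.cong (a ℕ.+_) s≡n∸a) (ℕₚ.m+[n∸m]≡n a≤n)) ⟩
    x * y                               ≈⟨ *-congˡ ([]?-yes (yes s≡n∸a) s≡n∸a) ⟨
    x * [ yes s≡n∸a ]? y                ≈⟨ []?-yes (yes a≤n) a≤n ⟨
    [ yes a≤n ]? (x * [ yes s≡n∸a ]? y) ∎
  ... | yes a≤n | no s≢n∸a = begin
    [ a ℕ.+ s ℕ.≟ n ]? (x * y)          ≈⟨ []?-no (a ℕ.+ s ℕ.≟ n) (λ a+s≡n → s≢n∸a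
                                             (≡.trans (≡.sym (ℕₚ.m+n∸m≡n a s)) (≡.cong (ℕ._∸ a) a+s≡n))) ⟩
    0#                                  ≈⟨ trans (*-congˡ ([]?-no (no s≢n∸a) s≢n∸a)) (zeroʳ x) ⟨
    x * [ no s≢n∸a ]? y                 ≈⟨ []?-yes (yes a≤n) a≤n ⟨
    [ yes a≤n ]? (x * [ no s≢n∸a ]? y)  ∎
  ... | no a≰n | _ = trans ([]?-no (a ℕ.+ s ℕ.≟ n) λ a+s≡n → a≰n (≡.subst (a ≤_) a+s≡n (ℕₚ.m≤m+n a s)))
                           (sym ([]?-no (no a≰n) a≰n))

  sumL-cong : ∀ {b} {X : Set b} (xs : List X) {f g : X → Carrier} → (∀ x → f x ≈ g x) → sumL xs f ≈ sumL xs g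
  sumL-cong []       f≈g = refl
  sumL-cong (x ∷ xs) f≈g = +-cong (f≈g x) (sumL-cong xs f≈g)

  sumL-++ : ∀ {b} {X : Set b} (xs ys : List X) f → sumL (xs ++ ys) f ≈ sumL xs f + sumL ys f
  sumL-++ []       ys f = sym (+-identityˡ _)
  sumL-++ (x ∷ xs) ys f = trans (+-congˡ (sumL-++ xs ys f)) (sym (+-assoc _ _ _))

  sumL-concatMap : ∀ {b c} {X : Set b} {Y : Set c} (g : X → List Y) (xs : List X) f →
    sumL (concatMap g xs) f ≈ sumL xs (λ x → sumL (g x) f)
  sumL-concatMap g []       f = refl
  sumL-concatMap g (x ∷ xs) f = trans (sumL-++ (g x) (concatMap g xs) f) (+-congˡ (sumL-concatMap g xs f))

  sumL-map : ∀ {b c} {X : Set b} {Y : Set c} (g : X → Y) (xs : List X) f →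
    sumL (map g xs) f ≡ sumL xs (λ x → f (g x))
  sumL-map g []       f = ≡.refl
  sumL-map g (x ∷ xs) f = ≡.cong (f (g x) +_) (sumL-map g xs f)

module NonvanishingFactorials {c ℓ} (F : Field c ℓ) (r : ℕ) (_≟_ : Decidable (Field._≈_ F)) (r≥2 : 2 ≤ r) where
  open Field F
  open Carlitz F r
  open PolynomialDomain F r _≟_

  -1≉0 : ¬ (0# + - 1#) ≈ 0#
  -1≉0 -1≈0 = 0≉1 (sym (begin
    1#                ≈⟨ +-identityʳ 1# ⟨
    1# + 0#           ≈⟨ +-congˡ (trans (sym (+-identityˡ _)) -1≈0) ⟨
    1# + (- 1#)       ≈⟨ -‿inverseʳ 1# ⟩
    0#                ∎))
    where open SetoidReasoning setoid

  -- the coefficient of T in [j] = T^(r^j) - T is -1, as r^j ≥ 2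
  bracket-nonzero : ∀ j → 1 ≤ j → ¬ bracket j ≈ₚ 0ₚ
  bracket-nonzero j 1≤j = ≡.subst (λ e → ¬ (T^ e +ₚ (-ₚ T^ 1)) ≈ₚ 0ₚ) (ℕₚ.m+[n∸m]≡n 2≤r^j)
    (λ [j]≈0 → -1≉0 ([j]≈0 1))
    where 2≤r^j = ℕₚ.≤-trans (s≤s 1≤j) (n<r^n r≥2 j)

  ^ₚ-nonzero : ∀ p k → ¬ p ≈ₚ 0ₚ → ¬ (p ^ₚ k) ≈ₚ 0ₚ
  ^ₚ-nonzero p zero    p≉0 = 1ₚ-nonzero
  ^ₚ-nonzero p (suc k) p≉0 = *ₚ-nonzero p (p ^ₚ k) p≉0 (^ₚ-nonzero p k p≉0)

  prodₚ-map-nonzero : ∀ {A : Set} (f : A → Poly) {xs} →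
                      All (λ x → ¬ f x ≈ₚ 0ₚ) xs → ¬ prodₚ (map f xs) ≈ₚ 0ₚ
  prodₚ-map-nonzero f []                 = 1ₚ-nonzero
  prodₚ-map-nonzero f {x ∷ xs} (fx≉0 ∷ fxs≉0) = *ₚ-nonzero (f x) _ fx≉0 (prodₚ-map-nonzero f fxs≉0)

  D-nonzero : ∀ i → ¬ D i ≈ₚ 0ₚ
  D-nonzero i = prodₚ-map-nonzero (λ j → bracket (i ℕ.∸ j) ^ₚ (r ℕ.^ j))
    (All.applyUpTo⁺₁ (λ j → j) i λ {j} j<i →
      ^ₚ-nonzero _ (r ℕ.^ j) (bracket-nonzero (i ℕ.∸ j) (ℕₚ.m<n⇒0<n∸m j<i)))

  CarlitzFact-nonzero : ∀ n → ¬ CarlitzFact n ≈ₚ 0ₚ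
  CarlitzFact-nonzero n = prodₚ-map-nonzero (λ j → D j ^ₚ digit j n)
    (All.applyUpTo⁺₂ (λ j → j) (suc n) λ j → ^ₚ-nonzero (D j) (digit j n) (D-nonzero j))


module TruncatedBernoulliCarlitz {c ℓ} (F : Field c ℓ) (r : ℕ) (r≥2 : 2 ≤ r) (N : ℕ) where
  open Carlitz F r using (tuples; sumℕ)

  R : ℕ
  R = r ℕ.^ N

  -- the exponent of the (N + t)-th term x^(r^(N+t))/D_(N+t) of e_C
  w : ℕ → ℕ
  w t = r ℕ.^ (N ℕ.+ t)

  t<w : ∀ t → t < w t
  t<w t = ℕₚ.≤-<-trans (ℕₚ.m≤n+m t N) (n<r^n r≥2 (N ℕ.+ t))

  ≤⇒w≰ : ∀ {t T} → T ≤ t → ¬ w t ≤ T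
  ≤⇒w≰ T≤t w≤T = ℕₚ.<⇒≱ (t<w _) (ℕₚ.≤-trans w≤T T≤t)

  R<w[1+t] : ∀ t → R < w (suc t)
  R<w[1+t] t = ℕₚ.^-monoʳ-< r r≥2 (ℕₚ.m<m+n N (s≤s z≤n))

  w0≡R : w 0 ≡ R
  w0≡R = ≡.cong (r ℕ.^_) (ℕₚ.+-identityʳ N)

  m∸n<o : ∀ {m n o} → n ≤ m → m < n ℕ.+ o → m ℕ.∸ n < o
  m∸n<o {m} {n} {o} n≤m m<n+o = ℕₚ.+-cancelˡ-< n (m ℕ.∸ n) o
    (≡.subst (ℕ._< n ℕ.+ o) (≡.sym (ℕₚ.m+[n∸m]≡n n≤m)) m<n+o)

  -- The argument works in any commutative ring, with E i in the role of 1/D_i and d in that of D_N.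
  module Inversion {a ℓ′} (A : CommutativeRing a ℓ′) (E : ℕ → CommutativeRing.Carrier A)
                   (d : CommutativeRing.Carrier A)
                   (d*E[N]≈1 : CommutativeRing._≈_ A (CommutativeRing._*_ A d (E N)) (CommutativeRing.1# A))
                   where
    open CommutativeRing A
    open import Algebra.Properties.Semiring.Exp semiring using (_^_)
    open FiniteSums A
    open GroupProperties +-group using (x≈z//y; ∙-cancelʳ)
    open RingProperties ring using (-‿distribʳ-*; -1*x≈-x)
    open Solver commutativeSemiring using (solve; _:=_; _:*_)
    open SetoidReasoning setoid

    h : ℕ → Carrier
    h t = E (N ℕ.+ t)

    -- e i j is the coefficient of x^j in x^(r^i)/D_i
    e : ℕ → ℕ → Carrier
    e i j = [ r ℕ.^ i ℕ.≟ j ]? E i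

    δ : ℕ → Carrier
    δ = e N

    e-vanishes : ∀ {i j} → j < i → e i j ≈ 0#
    e-vanishes {i} j<i = []?-no (r ℕ.^ i ℕ.≟ _) λ r^i≡j → ℕₚ.<-asym j<i (≡.subst (i <_) r^i≡j (n<r^n r≥2 i))

    ∑-indicator : ∀ a m x (f : ℕ → Carrier) →
                  ∑ (suc m) (λ j → ([ a ℕ.≟ j ]? x) * f j) ≈ [ a ℕ.≤? m ]? (x * f a)
    ∑-indicator a m x f with a ℕ.≤? m
    ... | yes a≤m = begin
      ∑ (suc m) (λ j → ([ a ℕ.≟ j ]? x) * f j)  ≈⟨ ∑-single _ (s≤s a≤m) off ⟩
      ([ a ℕ.≟ a ]? x) * f a                   ≈⟨ *-congʳ ([]?-yes (a ℕ.≟ a) ≡.refl) ⟩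
      x * f a                                  ≈⟨ []?-yes (yes a≤m) a≤m ⟨
      [ yes a≤m ]? (x * f a)                   ∎
      where
      off : ∀ j → j < suc m → j ≢ a → ([ a ℕ.≟ j ]? x) * f j ≈ 0#
      off j _ j≢a = trans (*-congʳ ([]?-no (a ℕ.≟ j) λ a≡j → j≢a (≡.sym a≡j))) (zeroˡ _)
    ... | no a≰m = trans (∑-zero (suc m) off) (sym ([]?-no (no a≰m) a≰m))
      where
      off : ∀ j → j < suc m → ([ a ℕ.≟ j ]? x) * f j ≈ 0#
      off j j≤m = trans (*-congʳ ([]?-no (a ℕ.≟ j) λ { ≡.refl → a≰m (ℕₚ.≤-pred j≤m) })) (zeroˡ _)

    e_C-split : ∀ j → ∑ (suc j) (λ i → e i j) ≈ ∑ N (λ i → e i j) + ∑ (suc j) (λ t → e (N ℕ.+ t) j)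
    e_C-split j = trans (∑-extend (λ i → e i j) (ℕₚ.m≤n+m (suc j) N) λ i j<i _ → e-vanishes j<i)
                        (∑-split N (suc j) (λ i → e i j))

    -- the coefficient of x^m in (∑_t x^(r^(N+t))/D_(N+t)) · ∑_n u_n x^n
    conv : (ℕ → Carrier) → ℕ → Carrier
    conv u m = ∑ (suc m) (λ t → [ w t ℕ.≤? m ]? (h t * u (m ℕ.∸ w t)))

    product-coefficient : (ℕ → Carrier) → ℕ → Carrier
    product-coefficient u m = ∑ (suc m) (λ j → (∑ (suc j) (λ i → e i j) - ∑ N (λ i → e i j)) * u (m ℕ.∸ j))

    product-coefficient≈conv : ∀ u m → product-coefficient u m ≈ conv u m
    product-coefficient≈conv u m = begin
      product-coefficient u m
        ≈⟨ ∑-cong-< (suc m) (λ j j≤m → *-congʳ (difference j j≤m)) ⟩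
      ∑ (suc m) (λ j → ∑ (suc m) (λ t → e (N ℕ.+ t) j) * u (m ℕ.∸ j))
        ≈⟨ ∑-cong (suc m) (λ j → ∑-*ʳ (suc m) (u (m ℕ.∸ j)) (λ t → e (N ℕ.+ t) j)) ⟩
      ∑ (suc m) (λ j → ∑ (suc m) (λ t → e (N ℕ.+ t) j * u (m ℕ.∸ j)))
        ≈⟨ ∑-swap (suc m) (suc m) (λ j t → e (N ℕ.+ t) j * u (m ℕ.∸ j)) ⟩
      ∑ (suc m) (λ t → ∑ (suc m) (λ j → e (N ℕ.+ t) j * u (m ℕ.∸ j)))
        ≈⟨ ∑-cong (suc m) (λ t → ∑-indicator (w t) m (h t) (λ j → u (m ℕ.∸ j))) ⟩
      conv u m
        ∎
      where
      difference : ∀ j → j < suc m →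
        ∑ (suc j) (λ i → e i j) - ∑ N (λ i → e i j) ≈ ∑ (suc m) (λ t → e (N ℕ.+ t) j)
      difference j j≤m = begin
        ∑ (suc j) (λ i → e i j) - ∑ N (λ i → e i j)
          ≈⟨ +-congʳ (trans (e_C-split j) (+-comm (∑ N (λ i → e i j)) _)) ⟩
        (∑ (suc j) (λ t → e (N ℕ.+ t) j) + ∑ N (λ i → e i j)) - ∑ N (λ i → e i j)
          ≈⟨ x≈z//y _ (∑ N (λ i → e i j)) _ refl ⟨
        ∑ (suc j) (λ t → e (N ℕ.+ t) j)
          ≈⟨ ∑-extend (λ t → e (N ℕ.+ t) j) j≤m
                      (λ t j<t _ → e-vanishes (ℕₚ.<-≤-trans j<t (ℕₚ.m≤n+m t N))) ⟩
        ∑ (suc m) (λ t → e (N ℕ.+ t) j)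
          ∎


    h0≈E[N] : h 0 ≈ E N
    h0≈E[N] = reflexive (≡.cong E (ℕₚ.+-identityʳ N))

    d*h0≈1 : d * h 0 ≈ 1#
    d*h0≈1 = trans (*-congˡ h0≈E[N]) d*E[N]≈1

    *-cancelˡ-invertible : ∀ {a b x y} → a * b ≈ 1# → b * x ≈ b * y → x ≈ y
    *-cancelˡ-invertible {a} {b} {x} {y} ab≈1 bx≈by = begin
      x              ≈⟨ trans (sym (*-identityˡ x)) (*-congʳ (sym ab≈1)) ⟩
      (a * b) * x    ≈⟨ trans (*-assoc a b x) (*-congˡ bx≈by) ⟩
      a * (b * y)    ≈⟨ trans (sym (*-assoc a b y)) (*-congʳ ab≈1) ⟩
      1# * y         ≈⟨ *-identityˡ y ⟩
      y              ∎

    conv-tail : (ℕ → Carrier) → ℕ → Carrier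
    conv-tail u n = ∑ (R ℕ.+ n) (λ t → [ w (suc t) ℕ.≤? R ℕ.+ n ]? (h (suc t) * u (R ℕ.+ n ℕ.∸ w (suc t))))

    conv-split : ∀ u n → conv u (R ℕ.+ n) ≈ h 0 * u n + conv-tail u n
    conv-split u n = begin
      conv u (R ℕ.+ n)
        ≡⟨ ∑-suc (R ℕ.+ n) _ ⟩
      [ w 0 ℕ.≤? R ℕ.+ n ]? (h 0 * u (R ℕ.+ n ℕ.∸ w 0)) + conv-tail u n
        ≈⟨ +-congʳ ([]?-yes _ w0≤R+n) ⟩
      h 0 * u (R ℕ.+ n ℕ.∸ w 0) + conv-tail u n
        ≡⟨ ≡.cong (λ k → h 0 * u k + conv-tail u n) R+n∸w0≡n ⟩
      h 0 * u n + conv-tail u n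
        ∎
      where
      w0≤R+n : w 0 ≤ R ℕ.+ n
      w0≤R+n = ≡.subst (ℕ._≤ R ℕ.+ n) (≡.sym w0≡R) (ℕₚ.m≤m+n R n)
      R+n∸w0≡n : R ℕ.+ n ℕ.∸ w 0 ≡ n
      R+n∸w0≡n = ≡.trans (≡.cong (R ℕ.+ n ℕ.∸_) w0≡R) (ℕₚ.m+n∸m≡n R n)

    R+n∸w[1+t]<n : ∀ n t → w (suc t) ≤ R ℕ.+ n → R ℕ.+ n ℕ.∸ w (suc t) < n
    R+n∸w[1+t]<n n t w≤R+n = m∸n<o w≤R+n (ℕₚ.+-monoˡ-< n (R<w[1+t] t))

    conv-tail-cong : ∀ {u v} n → (∀ {k} → k < n → u k ≈ v k) → conv-tail u n ≈ conv-tail v n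
    conv-tail-cong n u≈v = ∑-cong (R ℕ.+ n) λ t → []?-cong (w (suc t) ℕ.≤? R ℕ.+ n) λ w≤R+n →
      *-congˡ (u≈v (R+n∸w[1+t]<n n t w≤R+n))

    conv-injective : ∀ {u v} → (∀ n → conv u (R ℕ.+ n) ≈ conv v (R ℕ.+ n)) → ∀ n → u n ≈ v n
    conv-injective {u} {v} conv-u≈conv-v = <-rec (λ n → u n ≈ v n) λ n u≈v →
      *-cancelˡ-invertible d*h0≈1 (∙-cancelʳ (conv-tail u n) _ _ (begin
        h 0 * u n + conv-tail u n   ≈⟨ conv-split u n ⟨
        conv u (R ℕ.+ n)            ≈⟨ conv-u≈conv-v n ⟩
        conv v (R ℕ.+ n)            ≈⟨ conv-split v n ⟩
        h 0 * v n + conv-tail v n   ≈⟨ +-congˡ (conv-tail-cong n u≈v) ⟨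
        h 0 * v n + conv-tail u n   ∎))

    -- Q T k = ∑ of h i₁ ⋯ h i_k over i₁, …, i_k ≥ 1 with w i₁ + ⋯ + w i_k = T, by recursion on i₁
    Q : ℕ → ℕ → Carrier
    Q T zero    = [ 0 ℕ.≟ T ]? 1#
    Q T (suc k) = ∑ T (λ t → [ w (suc t) ℕ.≤? T ]? (h (suc t) * Q (T ℕ.∸ w (suc t)) k))

    ∏h : List ℕ → Carrier
    ∏h []       = 1#
    ∏h (i ∷ is) = h i * ∏h is

    tupleSum : ℕ → ℕ → ℕ → Carrier
    tupleSum B T k = sumL (tuples k B) (λ is → [ sumℕ (map w is) ℕ.≟ T ]? ∏h is)

    tupleSum-suc : ∀ B T k →
      tupleSum B T (suc k) ≈ ∑ B (λ t → [ w (suc t) ℕ.≤? T ]? (h (suc t) * tupleSum B (T ℕ.∸ w (suc t)) k))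
    tupleSum-suc B T k = begin
      tupleSum B T (suc k)
        ≈⟨ sumL-concatMap (λ i → map (i ∷_) (tuples k B)) (map suc (upTo B)) f ⟩
      sumL (map suc (upTo B)) (λ i → sumL (map (i ∷_) (tuples k B)) f)
        ≡⟨ ≡.trans (sumL-map suc (upTo B) _) (sumL-applyUpTo (λ i → i) B _) ⟩
      ∑ B (λ t → sumL (map (suc t ∷_) (tuples k B)) f)
        ≈⟨ ∑-cong B (λ t → reflexive (sumL-map (suc t ∷_) (tuples k B) f)) ⟩
      ∑ B (λ t → sumL (tuples k B) (λ is → f (suc t ∷ is)))
        ≈⟨ ∑-cong B (λ t → sumL-cong (tuples k B) λ is →
             [+≟]?-* (w (suc t)) (sumℕ (map w is)) T (h (suc t)) (∏h is)) ⟩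
      ∑ B (λ t → sumL (tuples k B) (λ is →
        [ w (suc t) ℕ.≤? T ]? (h (suc t) * [ sumℕ (map w is) ℕ.≟ T ℕ.∸ w (suc t) ]? ∏h is)))
        ≈⟨ ∑-cong B (λ t → sumL-[]?-*ˡ (w (suc t) ℕ.≤? T) (tuples k B) (h (suc t)) _) ⟩
      ∑ B (λ t → [ w (suc t) ℕ.≤? T ]? (h (suc t) * tupleSum B (T ℕ.∸ w (suc t)) k))
        ∎
      where
      f : List ℕ → Carrier
      f is = [ sumℕ (map w is) ℕ.≟ T ]? ∏h is

    tupleSum≈Q : ∀ k {B T} → T ≤ B → tupleSum B T k ≈ Q T k
    tupleSum≈Q zero    T≤B = +-identityʳ _
    tupleSum≈Q (suc k) {B} {T} T≤B = begin
      tupleSum B T (suc k)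
        ≈⟨ tupleSum-suc B T k ⟩
      ∑ B (λ t → [ w (suc t) ℕ.≤? T ]? (h (suc t) * tupleSum B (T ℕ.∸ w (suc t)) k))
        ≈⟨ ∑-cong B (λ t → []?-cong (w (suc t) ℕ.≤? T) λ _ →
             *-congˡ (tupleSum≈Q k (ℕₚ.≤-trans (ℕₚ.m∸n≤m T (w (suc t))) T≤B))) ⟩
      ∑ B (λ t → [ w (suc t) ℕ.≤? T ]? (h (suc t) * Q (T ℕ.∸ w (suc t)) k))
        ≈⟨ ∑-extend _ T≤B (λ t T≤t _ → []?-no (w (suc t) ℕ.≤? T) (≤⇒w≰ (ℕₚ.m≤n⇒m≤1+n T≤t))) ⟨
      Q T (suc k)
        ∎

    Q-vanishes : ∀ k {T} → T < k ℕ.* suc R → Q T k ≈ 0#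
    Q-vanishes (suc k) {T} T<[1+k][1+R] = ∑-zero T λ t _ → []?-≈0 (w (suc t) ℕ.≤? T) λ w≤T →
      trans (*-congˡ (Q-vanishes k (m∸n<o w≤T (ℕₚ.<-≤-trans T<[1+k][1+R] (ℕₚ.+-monoˡ-≤ _ (R<w[1+t] t))))))
            (zeroʳ _)

    cterm : ℕ → ℕ → Carrier
    cterm n k = (- d) ^ k * Q (n ℕ.+ k ℕ.* R) k

    -- the series ∑_{k ≤ n} (-D_N)^k ∑_{…} 1/(D_{N+i₁} ⋯ D_{N+i_k}) of the theorem, before multiplying by Π(n)
    candidate : ℕ → Carrier
    candidate n = ∑ (suc n) (cterm n)

    cterm-vanishes : ∀ {n k} → n < k → cterm n k ≈ 0#
    cterm-vanishes {n} {k} n<k = trans (*-congˡ (Q-vanishes k n+kR<k[1+R])) (zeroʳ _)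
      where
      n+kR<k[1+R] : n ℕ.+ k ℕ.* R < k ℕ.* suc R
      n+kR<k[1+R] = ≡.subst (n ℕ.+ k ℕ.* R <_) (≡.sym (ℕₚ.*-suc k R)) (ℕₚ.+-monoˡ-< (k ℕ.* R) n<k)

    candidate-extend : ∀ {L} n → suc n ≤ L → ∑ L (cterm n) ≈ candidate n
    candidate-extend n n<L = sym (∑-extend (cterm n) n<L λ k n<k _ → cterm-vanishes n<k)

    Q-suc-+ : ∀ m k → Q (m ℕ.+ k ℕ.* R) (suc k) ≈
      ∑ m (λ t → [ w (suc t) ℕ.≤? m ]? (h (suc t) * Q (m ℕ.∸ w (suc t) ℕ.+ k ℕ.* R) k))
    Q-suc-+ m k = begin
      Q T (suc k)
        ≈⟨ ∑-cong T (λ t → term t (w (suc t) ℕ.≤? T) (w (suc t) ℕ.≤? m)) ⟩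
      ∑ T (λ t → [ w (suc t) ℕ.≤? m ]? (h (suc t) * Q (m ℕ.∸ w (suc t) ℕ.+ k ℕ.* R) k))
        ≈⟨ ∑-extend _ (ℕₚ.m≤m+n m (k ℕ.* R))
                    (λ t m≤t _ → []?-no (w (suc t) ℕ.≤? m) (≤⇒w≰ (ℕₚ.m≤n⇒m≤1+n m≤t))) ⟨
      ∑ m (λ t → [ w (suc t) ℕ.≤? m ]? (h (suc t) * Q (m ℕ.∸ w (suc t) ℕ.+ k ℕ.* R) k))
        ∎
      where
      T = m ℕ.+ k ℕ.* R
      -- a tuple whose first part exceeds m leaves less than k R for the remaining k parts
      term : ∀ t (w≤T? : Dec (w (suc t) ≤ T)) (w≤m? : Dec (w (suc t) ≤ m)) →
             [ w≤T? ]? (h (suc t) * Q (T ℕ.∸ w (suc t)) k) ≈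
             [ w≤m? ]? (h (suc t) * Q (m ℕ.∸ w (suc t) ℕ.+ k ℕ.* R) k)
      term t (yes w≤T) (yes w≤m) = trans ([]?-yes (yes w≤T) w≤T) (trans
        (*-congˡ (reflexive (≡.cong (λ i → Q i k) (ℕₚ.+-∸-comm (k ℕ.* R) w≤m)))) (sym ([]?-yes (yes w≤m) w≤m)))
      term t (yes w≤T) (no w≰m)  = trans ([]?-yes (yes w≤T) w≤T) (trans
        (trans (*-congˡ (Q-vanishes k T∸w<k[1+R])) (zeroʳ _)) (sym ([]?-no (no w≰m) w≰m)))
        where
        T∸w<k[1+R] : T ℕ.∸ w (suc t) < k ℕ.* suc R
        T∸w<k[1+R] = ℕₚ.<-≤-trans (m∸n<o w≤T (ℕₚ.+-monoˡ-< (k ℕ.* R) (ℕₚ.≰⇒> w≰m)))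
                                  (ℕₚ.*-monoʳ-≤ k (ℕₚ.n≤1+n R))
      term t (no w≰T)  (yes w≤m) = ⊥-elim (w≰T (ℕₚ.≤-trans w≤m (ℕₚ.m≤m+n m (k ℕ.* R))))
      term t (no w≰T)  (no w≰m)  = trans ([]?-no (no w≰T) w≰T) (sym ([]?-no (no w≰m) w≰m))

    ∑-[-d]^[1+k]*Q : ∀ {n m} x → m < n →
      ∑ n (λ k → (- d) ^ suc k * (x * Q (m ℕ.+ k ℕ.* R) k)) ≈ (- d) * (x * candidate m)
    ∑-[-d]^[1+k]*Q {n} {m} x m<n = begin
      ∑ n (λ k → (- d) ^ suc k * (x * Q (m ℕ.+ k ℕ.* R) k))
        ≈⟨ ∑-cong n (λ k → rearrange (- d) ((- d) ^ k) x _) ⟩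
      ∑ n (λ k → (- d) * (x * cterm m k))
        ≈⟨ trans (*-congˡ (∑-*ˡ n x (cterm m))) (∑-*ˡ n (- d) _) ⟨
      (- d) * (x * ∑ n (cterm m))
        ≈⟨ *-congˡ (*-congˡ (candidate-extend m m<n)) ⟩
      (- d) * (x * candidate m)
        ∎
      where
      rearrange : ∀ a p x q → (a * p) * (x * q) ≈ a * (x * (p * q))
      rearrange = solve 4 (λ a p x q → (a :* p) :* (x :* q) := a :* (x :* (p :* q))) refl

    ∑-cterm-suc : ∀ n → ∑ n (λ k → cterm n (suc k)) ≈ (- d) * conv-tail candidate n
    ∑-cterm-suc n = begin
      ∑ n (λ k → cterm n (suc k))
        ≈⟨ ∑-cong n (λ k → *-congˡ (trans (reflexive (≡.cong (λ i → Q i (suc k)) (n+[1+k]R≡R+n+kR k)))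
                                          (Q-suc-+ m k))) ⟩
      ∑ n (λ k → (- d) ^ suc k * ∑ m (Y k))
        ≈⟨ ∑-cong n (λ k → ∑-*ˡ m ((- d) ^ suc k) (Y k)) ⟩
      ∑ n (λ k → ∑ m (λ t → (- d) ^ suc k * Y k t))
        ≈⟨ ∑-swap n m (λ k t → (- d) ^ suc k * Y k t) ⟩
      ∑ m (λ t → ∑ n (λ k → (- d) ^ suc k * Y k t))
        ≈⟨ ∑-cong m (λ t → ∑-[-d]^[1+k]*Y t (w (suc t) ℕ.≤? m)) ⟩
      ∑ m (λ t → (- d) * [ w (suc t) ℕ.≤? m ]? (h (suc t) * candidate (m ℕ.∸ w (suc t))))
        ≈⟨ ∑-*ˡ m (- d) _ ⟨
      (- d) * conv-tail candidate n
        ∎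
      where
      m = R ℕ.+ n
      Y : ℕ → ℕ → Carrier
      Y k t = [ w (suc t) ℕ.≤? m ]? (h (suc t) * Q (m ℕ.∸ w (suc t) ℕ.+ k ℕ.* R) k)
      n+[1+k]R≡R+n+kR : ∀ k → n ℕ.+ suc k ℕ.* R ≡ m ℕ.+ k ℕ.* R
      n+[1+k]R≡R+n+kR k = ≡.trans (≡.sym (ℕₚ.+-assoc n R (k ℕ.* R))) (≡.cong (ℕ._+ k ℕ.* R) (ℕₚ.+-comm n R))
      ∑-[-d]^[1+k]*Y : ∀ t (w≤m? : Dec (w (suc t) ≤ m)) →
        ∑ n (λ k → (- d) ^ suc k * [ w≤m? ]? (h (suc t) * Q (m ℕ.∸ w (suc t) ℕ.+ k ℕ.* R) k)) ≈
        (- d) * [ w≤m? ]? (h (suc t) * candidate (m ℕ.∸ w (suc t)))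
      ∑-[-d]^[1+k]*Y t (yes w≤m) = begin
        ∑ n (λ k → (- d) ^ suc k * [ yes w≤m ]? (h (suc t) * Q (m ℕ.∸ w (suc t) ℕ.+ k ℕ.* R) k))
          ≈⟨ ∑-cong n (λ k → *-congˡ ([]?-yes (yes w≤m) w≤m)) ⟩
        ∑ n (λ k → (- d) ^ suc k * (h (suc t) * Q (m ℕ.∸ w (suc t) ℕ.+ k ℕ.* R) k))
          ≈⟨ ∑-[-d]^[1+k]*Q (h (suc t)) (R+n∸w[1+t]<n n t w≤m) ⟩
        (- d) * (h (suc t) * candidate (m ℕ.∸ w (suc t)))
          ≈⟨ *-congˡ ([]?-yes (yes w≤m) w≤m) ⟨
        (- d) * [ yes w≤m ]? (h (suc t) * candidate (m ℕ.∸ w (suc t)))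
          ∎
      ∑-[-d]^[1+k]*Y t (no w≰m) = begin
        ∑ n (λ k → (- d) ^ suc k * [ no w≰m ]? _)
          ≈⟨ ∑-zero n (λ k _ → trans (*-congˡ ([]?-no (no w≰m) w≰m)) (zeroʳ _)) ⟩
        0#
          ≈⟨ trans (*-congˡ ([]?-no (no w≰m) w≰m)) (zeroʳ _) ⟨
        (- d) * [ no w≰m ]? _
          ∎

    cterm[1+n]0≈0 : ∀ n → cterm (suc n) 0 ≈ 0#
    cterm[1+n]0≈0 n = trans (*-identityˡ _) ([]?-no (0 ℕ.≟ suc n ℕ.+ 0) λ ())

    h0*cterm0≈δ : ∀ n → h 0 * cterm n 0 ≈ δ (R ℕ.+ n)
    h0*cterm0≈δ zero = begin
      h 0 * (1# * [ 0 ℕ.≟ 0 ]? 1#)   ≈⟨ *-congˡ (trans (*-identityˡ _) ([]?-yes (0 ℕ.≟ 0) ≡.refl)) ⟩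
      h 0 * 1#                       ≈⟨ trans (*-identityʳ _) h0≈E[N] ⟩
      E N                            ≈⟨ []?-yes (R ℕ.≟ R ℕ.+ 0) (≡.sym (ℕₚ.+-identityʳ R)) ⟨
      δ (R ℕ.+ 0)                    ∎
    h0*cterm0≈δ (suc n) = begin
      h 0 * cterm (suc n) 0                  ≈⟨ trans (*-congˡ (cterm[1+n]0≈0 n)) (zeroʳ _) ⟩
      0#                                     ≈⟨ []?-no (R ℕ.≟ R ℕ.+ suc n) (λ R≡R+1+n → ℕₚ.m≢1+n+m R
                                                  (≡.trans R≡R+1+n (ℕₚ.+-comm R (suc n)))) ⟨
      δ (R ℕ.+ suc n)                        ∎

    h0*[-d]≈-1 : h 0 * (- d) ≈ - 1#
    h0*[-d]≈-1 = trans (sym (-‿distribʳ-* (h 0) d)) (-‿cong (trans (*-comm (h 0) d) d*h0≈1))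

    candidate-conv : ∀ n → conv candidate (R ℕ.+ n) ≈ δ (R ℕ.+ n)
    candidate-conv n = begin
      conv candidate (R ℕ.+ n)
        ≈⟨ conv-split candidate n ⟩
      h 0 * candidate n + S
        ≈⟨ +-congʳ (*-congˡ (trans (reflexive (∑-suc n (cterm n))) (+-congˡ (∑-cterm-suc n)))) ⟩
      h 0 * (cterm n 0 + (- d) * S) + S
        ≈⟨ +-congʳ (trans (distribˡ (h 0) _ _) (+-congˡ (sym (*-assoc (h 0) (- d) S)))) ⟩
      (h 0 * cterm n 0 + (h 0 * (- d)) * S) + S
        ≈⟨ +-congʳ (+-congˡ (trans (*-congʳ h0*[-d]≈-1) (-1*x≈-x S))) ⟩
      (h 0 * cterm n 0 + - S) + S
        ≈⟨ trans (+-assoc _ (- S) S) (trans (+-congˡ (-‿inverseˡ S)) (+-identityʳ _)) ⟩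
      h 0 * cterm n 0
        ≈⟨ h0*cterm0≈δ n ⟩
      δ (R ℕ.+ n)
        ∎
      where S = conv-tail candidate n

    series-solution : ∀ {u} → (∀ m → product-coefficient u m ≈ δ m) → ∀ n → u n ≈ candidate n
    series-solution {u} u-solves = conv-injective λ n → begin
      conv u (R ℕ.+ n)                  ≈⟨ product-coefficient≈conv u (R ℕ.+ n) ⟨
      product-coefficient u (R ℕ.+ n)   ≈⟨ u-solves (R ℕ.+ n) ⟩
      δ (R ℕ.+ n)                       ≈⟨ candidate-conv n ⟨
      conv candidate (R ℕ.+ n)          ∎

    candidate-suc : ∀ n → candidate (suc n) ≈ ∑ (suc n) (λ k → cterm (suc n) (suc k))
    candidate-suc n = begin
      candidate (suc n)                                       ≡⟨ ∑-suc (suc n) (cterm (suc n)) ⟩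
      cterm (suc n) 0 + ∑ (suc n) (λ k → cterm (suc n) (suc k))  ≈⟨ +-congʳ (cterm[1+n]0≈0 n) ⟩
      0# + ∑ (suc n) (λ k → cterm (suc n) (suc k))               ≈⟨ +-identityˡ _ ⟩
      ∑ (suc n) (λ k → cterm (suc n) (suc k))                    ∎

module BernoulliCarlitzFormula {c ℓ} (F : Field c ℓ) (r : ℕ) (_≟_ : Decidable (Field._≈_ F)) (r≥2 : 2 ≤ r)
                               (N : ℕ) where
  open Carlitz F r
    using (Poly; K; _≈K_; ι; recip; D; CarlitzFact; when≡; sumK; prodK; _+K_; _*K_; -K_; _^K_;
           eC; truncSum; genSeries; _-S_; _*S_; IsBC; innerSum; RHS; tuples)
  open Polynomials F r using (coeffwise; coeff-≈)
  open PolynomialDomain F r _≟_ using (1ₚ-nonzero)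
  open Fractions F r _≟_
  open NonvanishingFactorials F r _≟_ r≥2
  open TruncatedBernoulliCarlitz F r r≥2 N using (R; module Inversion)
  open CommutativeRing K⁺-commutativeRing
  open import Algebra.Properties.Semiring.Exp semiring using (_^_)
  open import Algebra.Properties.CommutativeSemigroup *-commutativeSemigroup using (x∙yz≈y∙xz)
  open FiniteSums K⁺-commutativeRing
  open SetoidReasoning setoid

  ι⁺ : Poly → K⁺
  ι⁺ p = ι p , 1ₚ-nonzero

  D⁻¹ : ℕ → K⁺
  D⁻¹ i = recip (D i) , D-nonzero i

  Π⁻¹ : ℕ → K⁺
  Π⁻¹ n = recip (CarlitzFact n) , CarlitzFact-nonzero n

  open Inversion K⁺-commutativeRing D⁻¹ (ι⁺ (D N)) (lift≃ (ι*recip (D N)))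

  ≈K⇒≈⁺ : ∀ {x y} → proj₁ x ≈K proj₁ y → x ≈ y
  ≈K⇒≈⁺ x≈y = lift≃ (cross (coeffwise x≈y))

  ≈⁺⇒≈K : ∀ {x y} → x ≈ y → proj₁ x ≈K proj₁ y
  ≈⁺⇒≈K x≈y = coeff-≈ (cross-≃ (lower≃ x≈y))

  when≡-lift : ∀ m n x → when≡ m n (proj₁ x) ≡ proj₁ ([ m ℕ.≟ n ]? x)
  when≡-lift m n x with m ℕ.≟ n
  ... | yes m≡n = ≡.cong proj₁ (≡.sym ([yes]?≡ m≡n x))
  ... | no m≢n  = ≡.cong proj₁ (≡.sym ([no]?≡ m≢n x))

  sumK-lift : ∀ {A : Set} {f : A → K} {g : A → K⁺} xs → (∀ x → f x ≡ proj₁ (g x)) →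
              sumK (map f xs) ≡ proj₁ (sumL xs g)
  sumK-lift []       f≡g = ≡.refl
  sumK-lift (x ∷ xs) f≡g = ≡.cong₂ _+K_ (f≡g x) (sumK-lift xs f≡g)

  sumK-upTo-lift : ∀ {f : ℕ → K} {g : ℕ → K⁺} n → (∀ i → f i ≡ proj₁ (g i)) →
                   sumK (map f (upTo n)) ≡ proj₁ (∑ n g)
  sumK-upTo-lift {g = g} n f≡g = ≡.trans (sumK-lift (upTo n) f≡g) (≡.cong proj₁ (sumL-applyUpTo (λ i → i) n g))

  prodK-lift : ∀ is → prodK (map (λ i → recip (D (N ℕ.+ i))) is) ≡ proj₁ (∏h is)
  prodK-lift []       = ≡.refl
  prodK-lift (i ∷ is) = ≡.cong (recip (D (N ℕ.+ i)) *K_) (prodK-lift is)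

  ^K-lift : ∀ x k → proj₁ x ^K k ≡ proj₁ (x ^ k)
  ^K-lift x zero    = ≡.refl
  ^K-lift x (suc k) = ≡.cong (proj₁ x *K_) (^K-lift x k)

  e_C-lift : ∀ j → eC j ≡ proj₁ (∑ (suc j) (λ i → e i j))
  e_C-lift j = sumK-upTo-lift (suc j) λ i → when≡-lift (r ℕ.^ i) j (D⁻¹ i)

  truncSum-lift : ∀ j → truncSum N j ≡ proj₁ (∑ N (λ i → e i j))
  truncSum-lift j = sumK-upTo-lift N λ i → when≡-lift (r ℕ.^ i) j (D⁻¹ i)

  innerSum-lift : ∀ n k → innerSum N n k ≡ proj₁ (tupleSum (n ℕ.+ k ℕ.* R) (n ℕ.+ k ℕ.* R) k)
  innerSum-lift n k = sumK-lift (tuples k T) λ is →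
    ≡.trans (≡.cong (when≡ _ T) (prodK-lift is)) (when≡-lift _ T (∏h is))
    where T = n ℕ.+ k ℕ.* R

  RHS-term : ℕ → ℕ → K⁺
  RHS-term n k = (- ι⁺ (D N)) ^ k * tupleSum (n ℕ.+ k ℕ.* R) (n ℕ.+ k ℕ.* R) k

  RHS-lift : ∀ n → RHS N n ≡ proj₁ (ι⁺ (CarlitzFact n) * ∑ n (λ k → RHS-term n (suc k)))
  RHS-lift n = ≡.cong (ι (CarlitzFact n) *K_) (≡.trans
    (sumK-lift (map suc (upTo n)) λ k → ≡.cong₂ _*K_ (^K-lift (- ι⁺ (D N)) k) (innerSum-lift n k))
    (≡.cong proj₁ (≡.trans (sumL-map suc (upTo n) (RHS-term n))
                           (sumL-applyUpTo (λ i → i) n (λ k → RHS-term n (suc k))))))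

  RHS-term≈cterm : ∀ n k → RHS-term n k ≈ cterm n k
  RHS-term≈cterm n k = *-congˡ {(- ι⁺ (D N)) ^ k} (tupleSum≈Q k ℕₚ.≤-refl)

  module _ (b : ℕ → K) (b-bc : IsBC N b) where
    b⁺ : ℕ → K⁺
    b⁺ n = b n , proj₁ b-bc n

    g : ℕ → K⁺
    g n = b⁺ n * Π⁻¹ n

    product-coefficient-lift : ∀ m → ((eC -S truncSum N) *S genSeries b) m ≡ proj₁ (product-coefficient g m)
    product-coefficient-lift m = sumK-upTo-lift (suc m) λ j →
      ≡.cong₂ (λ x y → (x +K (-K y)) *K genSeries b (m ℕ.∸ j)) (e_C-lift j) (truncSum-lift j)

    g-solves : ∀ m → product-coefficient g m ≈ δ m
    g-solves m = ≈K⇒≈⁺ {product-coefficient g m} {δ m}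
      (≡.subst₂ _≈K_ (product-coefficient-lift m) (when≡-lift R m (D⁻¹ N)) (proj₂ b-bc m))

    b≈Π*g : ∀ n → b⁺ n ≈ ι⁺ (CarlitzFact n) * g n
    b≈Π*g n = begin
      b⁺ n                     ≈⟨ *-identityʳ _ ⟨
      b⁺ n * 1#                ≈⟨ *-congˡ {b⁺ n} {ι⁺ Π * Π⁻¹ n} {1#} (lift≃ (ι*recip Π)) ⟨
      b⁺ n * (ι⁺ Π * Π⁻¹ n)    ≈⟨ x∙yz≈y∙xz (b⁺ n) (ι⁺ Π) (Π⁻¹ n) ⟩
      ι⁺ Π * (b⁺ n * Π⁻¹ n)    ∎
      where Π = CarlitzFact n

    bernoulli-carlitz-formula : ∀ n → b (suc n) ≈K RHS N (suc n)
    bernoulli-carlitz-formula n = ≡.subst (b (suc n) ≈K_) (≡.sym (RHS-lift (suc n))) (≈⁺⇒≈K (begin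
      b⁺ (suc n)
        ≈⟨ b≈Π*g (suc n) ⟩
      ι⁺ Π * g (suc n)
        ≈⟨ *-congˡ {ι⁺ Π} {g (suc n)} (series-solution {g} g-solves (suc n)) ⟩
      ι⁺ Π * candidate (suc n)
        ≈⟨ *-congˡ {ι⁺ Π} (candidate-suc n) ⟩
      ι⁺ Π * ∑ (suc n) (λ k → cterm (suc n) (suc k))
        ≈⟨ *-congˡ {ι⁺ Π} (∑-cong (suc n) λ k → RHS-term≈cterm (suc n) (suc k)) ⟨
      ι⁺ Π * ∑ (suc n) (λ k → RHS-term (suc n) (suc k))
        ∎))
      where Π = CarlitzFact (suc n)

module _ {c ℓ} (F : Field c ℓ) where
  open Field F

  ≈-decidable : ∀ {r} → HasCardinality F r → Decidable _≈_
  ≈-decidable (enum , enum-injective , enum-surjective) x y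
    with enum-surjective x | enum-surjective y
  ... | i , enum-i≈x | j , enum-j≈y with i Fin.≟ j
  ...   | yes ≡.refl = yes (trans (sym enum-i≈x) enum-j≈y)
  ...   | no i≢j     = no λ x≈y → i≢j (enum-injective i j (trans enum-i≈x (trans x≈y (sym enum-j≈y))))

primePower≥2 : ∀ {r} → IsPrimePower r → 2 ≤ r
primePower≥2 (p , k , p-prime , 1≤k , ≡.refl) = ℕₚ.≤-trans (s≤s 1≤k) (n<r^n p≥2 k)
  where p≥2 = ℕ.nonTrivial⇒n>1 p {{prime⇒nonTrivial p-prime}}

theorem1 : ∀ {c ℓ : Level} (F : Field c ℓ) (r : ℕ) →
    IsPrimePower r → HasCardinality F r →
    ∀ (N : ℕ) → 1 ≤ N →
    ∀ (b : ℕ → Carlitz.K F r) → Carlitz.IsBC F r N b →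
    ∀ (n : ℕ) → 1 ≤ n →
    Carlitz._≈K_ F r (b n) (Carlitz.RHS F r N n)
theorem1 F r r-prime-power card N _ b b-bc (suc n) _ =
  BernoulliCarlitzFormula.bernoulli-carlitz-formula F r (≈-decidable F card) (primePower≥2 r-prime-power) N b b-bc n
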